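{- There is an algorithm which, given $n$, computes $s(n)$, the number of tournament sequences of length $n$, with naive bit complexity $O(n^6)$.
   Context: A tournament sequence of length $n$ is a sequence of positive integers $(t_1,\ldots,t_n)$ with $t_1=1$ and $t_i<t_{i+1}\leq 2t_i$ for $1\leq i<n$. In the naive bit complexity model, computing $a+b$ costs time $O(\log a+\log b)$ and computing $ab$ costs time $O(\log a\log b)$ (the cost of the grade-school algorithms). -}

module Defs where

open import Data.Nat using (ℕ; zero; suc; _+_; _*_; _∸_; _<_; _≤_; _≟_)
open import Data.Nat.Logarithm using (⌈log₂_⌉)
open import Data.Vec using (Vec; []; _∷_)
open import Data.List using (List; lookup; length)
open import Data.Fin using (Fin; fromℕ<)
open import Data.Nat using (_<?_)
open import Data.Maybe using (Maybe; just; nothing)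
open import Data.Product using (_×_; _,_; Σ)
open import Data.Unit using (⊤)
open import Relation.Binary.PropositionalEquality using (_≡_)
open import Relation.Nullary using (yes; no)

Chain : ∀ {n} → Vec ℕ n → Set
Chain [] = ⊤
Chain (x ∷ []) = ⊤
Chain (x ∷ y ∷ rest) = (x < y) × (y ≤ 2 * x) × Chain (y ∷ rest)

-- (t_1, …, t_n) is a tournament sequence: t_1 = 1 and the chain condition.
-- (Positivity follows from t_1 = 1 and monotonicity.)
IsTournament : ∀ {n} → Vec ℕ n → Set
IsTournament [] = ⊤
IsTournament (x ∷ xs) = (x ≡ 1) × Chain (x ∷ xs)

-- The type of tournament sequences of length n; s(n) is its cardinality.
TournamentSeq : ℕ → Set
TournamentSeq n = Σ (Vec ℕ n) IsTournament

-- Register indices occurring literally in instructions are program constants.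

sz : ℕ → ℕ
sz a = suc ⌈log₂ (suc a)⌉

data Instr : Set where
  const : (d k : ℕ) → Instr
  add   : (d a b : ℕ) → Instr
  sub   : (d a b : ℕ) → Instr
  mul   : (d a b : ℕ) → Instr
  load  : (d a : ℕ) → Instr
  store : (a s : ℕ) → Instr
  jz    : (r l : ℕ) → Instr
  jmp   : (l : ℕ) → Instr
  halt  : Instr

Program : Set
Program = List Instr

Memory : Set
Memory = ℕ → ℕ

update : Memory → ℕ → ℕ → Memory
update m i v j with j ≟ i
... | yes _ = v
... | no  _ = m j

record Config : Set where
  constructor cfg
  field
    pc   : ℕ
    mem  : Memory
    cost : ℕ

data Step : Set where
  halted  : Memory → ℕ → Step
  running : Config → Step

exec : Instr → Config → Step
exec (const d k) (cfg p m c) = running (cfg (suc p) (update m d k) (c + sz k))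
exec (add d a b) (cfg p m c) = running (cfg (suc p) (update m d (m a + m b)) (c + (sz (m a) + sz (m b))))
exec (sub d a b) (cfg p m c) = running (cfg (suc p) (update m d (m a ∸ m b)) (c + (sz (m a) + sz (m b))))
exec (mul d a b) (cfg p m c) = running (cfg (suc p) (update m d (m a * m b)) (c + sz (m a) * sz (m b)))
exec (load d a)  (cfg p m c) = running (cfg (suc p) (update m d (m (m a))) (c + (sz (m a) + sz (m (m a)))))
exec (store a s) (cfg p m c) = running (cfg (suc p) (update m (m a) (m s)) (c + (sz (m a) + sz (m s))))
exec (jz r l)    (cfg p m c) with m r
... | zero  = running (cfg l m (suc c))
... | suc _ = running (cfg (suc p) m (suc c))
exec (jmp l)     (cfg p m c) = running (cfg l m (suc c))
exec halt        (cfg p m c) = halted m c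

step : Program → Config → Step
step P (cfg p m c) with p <? length P
... | yes p<  = exec (lookup P (fromℕ< p<)) (cfg p m c)
... | no  _   = halted m c

run : Program → ℕ → Config → Maybe (Memory × ℕ)
run P zero    k = nothing
run P (suc f) k with step P k
... | halted m c  = just (m , c)
... | running k'  = run P f k'

initial : ℕ → Config
initial n = cfg 0 (update (λ _ → 0) 0 n) 0

Computes : Program → ℕ → (out bound : ℕ) → Set
Computes P n out bound =
  Σ ℕ λ fuel → Σ Memory λ m → Σ ℕ λ c →
    (run P fuel (initial n) ≡ just (m , c)) × (m 0 ≡ out) × (c ≤ bound)

{-# OPTIONS --safe #-}
-- Let c_k(x) = chainCount k x count the ways to continue a tournament sequence ending in x by k
-- further terms: c_0 = 1, c_{k+1}(x) = Σ_{x<y≤2x} c_k(y) and s(n) = c_{n-1}(1). With the prefix sums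
-- C_k(y) = chainCountBelow k y = Σ_{z<y} c_k(z) one has c_{k+1}(x) = C_k(2x+1) - C_k(x+1), so by
-- induction c_k is a polynomial of degree at most k, determined by c_k(0), ..., c_k(L) with L = n + 1.
-- From these values the program computes, in place, the Newton differences Δ^j c_k(0), runs the
-- difference scheme forward to get c_k(x) and C_k(x) for x ≤ 2L + 1, and reads off c_{k+1}(0), ...,
-- c_{k+1}(L). All numbers stay below 2^E with E = O(n^2) bits, so each of the O(n^3) additions,
-- subtractions and array accesses of the n layers costs O(n^2): O(n^5) in total.

module Submission where

open import Defs
open import Data.Nat
  using (ℕ; zero; suc; NonZero; _+_; _*_; _∸_; _^_; _≤_; _<_; s≤s; z≤n; _≟_; _<?_; _<ᵇ_; _⊓_;
         _≤′_; ≤′-refl; ≤′-step)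
import Data.Nat.Properties as ℕ
open import Data.Integer as ℤ using (ℤ; 0ℤ; _⊖_)
import Data.Integer.Properties as ℤ
open import Data.Fin using (Fin)
open import Data.Vec using (Vec; []; _∷_)
open import Data.Product using (Σ; _×_; _,_; proj₁; proj₂)
open import Data.Sum using (_⊎_; inj₁; inj₂)
open import Data.Unit using (⊤; tt)
open import Data.Empty using (⊥; ⊥-elim)
open import Function using (_∘_)
open import Function.Bundles using (_↔_; mk↔ₛ′)
open import Relation.Nullary using (yes; no; ¬_)
open import Relation.Nullary.Decidable.Core using (toSum)
open import Relation.Binary.PropositionalEquality hiding (J)
open import Relation.Binary.Construct.Closure.ReflexiveTransitive using (Star; ε; _◅_; _◅◅_)

module Counting where
  open import Data.Fin.Properties using (+↔⊎; 0↔⊥; 1↔⊤)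
  open import Function.Properties.Inverse using (↔-trans)
  open import Data.Sum.Function.Propositional using (_⊎-↔_)

  sumFrom : ℕ → ℕ → (ℕ → ℕ) → ℕ
  sumFrom lo zero    c = 0
  sumFrom lo (suc d) c = c lo + sumFrom (suc lo) d c

  sumFrom-+ : ∀ lo a b c → sumFrom lo (a + b) c ≡ sumFrom lo a c + sumFrom (lo + a) b c
  sumFrom-+ lo zero    b c rewrite ℕ.+-identityʳ lo = refl
  sumFrom-+ lo (suc a) b c rewrite sumFrom-+ (suc lo) a b c | ℕ.+-suc lo a =
    sym (ℕ.+-assoc (c lo) (sumFrom (suc lo) a c) (sumFrom (suc (lo + a)) b c))

  chainCount : ℕ → ℕ → ℕ
  chainCount zero    x = 1
  chainCount (suc k) x = sumFrom (suc x) x (chainCount k)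

  chainCountBelow : ℕ → ℕ → ℕ
  chainCountBelow k y = sumFrom 0 y (chainCount k)

  tournamentCount : ℕ → ℕ
  tournamentCount n = chainCount (n ∸ 1) 1

  chainCountBelow-suc : ∀ k y → chainCountBelow k (suc y) ≡ chainCountBelow k y + chainCount k y
  chainCountBelow-suc k y = begin
    sumFrom 0 (suc y) (chainCount k)                   ≡⟨ cong (λ d → sumFrom 0 d (chainCount k)) (ℕ.+-comm 1 y) ⟩
    sumFrom 0 (y + 1) (chainCount k)                   ≡⟨ sumFrom-+ 0 y 1 (chainCount k) ⟩
    chainCountBelow k y + (chainCount k y + 0)         ≡⟨ cong (chainCountBelow k y +_) (ℕ.+-identityʳ _) ⟩
    chainCountBelow k y + chainCount k y               ∎
    where open ≡-Reasoning

  chainCountBelow-double : ∀ k x →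
    chainCountBelow k (suc x + x) ≡ chainCountBelow k (suc x) + chainCount (suc k) x
  chainCountBelow-double k x = sumFrom-+ 0 (suc x) x (chainCount k)

  chainCount-suc-∸ : ∀ k x → chainCount (suc k) x ≡ chainCountBelow k (suc x + x) ∸ chainCountBelow k (suc x)
  chainCount-suc-∸ k x = sym (trans (cong (_∸ chainCountBelow k (suc x)) (chainCountBelow-double k x))
                                    (ℕ.m+n∸m≡n (chainCountBelow k (suc x)) (chainCount (suc k) x)))

  Range : ℕ → ℕ → (ℕ → Set) → Set
  Range lo d Q = Σ ℕ λ y → (lo ≤ y × y < lo + d) × Q y

  Range-zero↔ : ∀ lo Q → ⊥ ↔ Range lo 0 Q
  Range-zero↔ lo Q = mk↔ₛ′ (λ ()) empty (λ r → ⊥-elim (empty r)) (λ ())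
    where
    empty : Range lo 0 Q → ⊥
    empty (y , (lo≤y , y<lo) , _) rewrite ℕ.+-identityʳ lo = ℕ.<-irrefl refl (ℕ.≤-<-trans lo≤y y<lo)

  Range-≡ : ∀ {lo d Q y} {p p′ : lo ≤ y} {q q′ : y < lo + d} {r : Q y} →
            _≡_ {A = Range lo d Q} (y , (p , q) , r) (y , (p′ , q′) , r)
  Range-≡ {p = p} {p′} {q} {q′} =
    cong₂ (λ u v → (_ , (u , v) , _)) (ℕ.≤-irrelevant p p′) (ℕ.<-irrelevant q q′)

  Range-suc↔ : ∀ lo d Q → (Q lo ⊎ Range (suc lo) d Q) ↔ Range lo (suc d) Q
  Range-suc↔ lo d Q = mk↔ₛ′ to from to∘from from∘to
    where
    lo+suc : lo + suc d ≡ suc lo + d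
    lo+suc = ℕ.+-suc lo d

    to : Q lo ⊎ Range (suc lo) d Q → Range lo (suc d) Q
    to (inj₁ q)                     = lo , (ℕ.≤-refl , subst (lo <_) (sym lo+suc) (s≤s (ℕ.m≤m+n lo d))) , q
    to (inj₂ (y , (lo<y , y<) , q)) = y , (ℕ.<⇒≤ lo<y , subst (y <_) (sym lo+suc) y<) , q

    from : Range lo (suc d) Q → Q lo ⊎ Range (suc lo) d Q
    from (y , (lo≤y , y<) , q) with ℕ.m≤n⇒m<n∨m≡n lo≤y
    ... | inj₂ refl = inj₁ q
    ... | inj₁ lo<y = inj₂ (y , (lo<y , subst (y <_) lo+suc y<) , q)

    to∘from : ∀ r → to (from r) ≡ r
    to∘from (y , (lo≤y , _) , _) with ℕ.m≤n⇒m<n∨m≡n lo≤y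
    ... | inj₂ refl = Range-≡
    ... | inj₁ _    = Range-≡

    from∘to : ∀ s → from (to s) ≡ s
    from∘to (inj₁ q) with ℕ.m≤n⇒m<n∨m≡n (ℕ.≤-refl {lo})
    ... | inj₂ refl = refl
    ... | inj₁ lo<lo = ⊥-elim (ℕ.<-irrefl refl lo<lo)
    from∘to (inj₂ (y , (lo<y , _) , _)) with ℕ.m≤n⇒m<n∨m≡n (ℕ.<⇒≤ lo<y)
    ... | inj₂ refl = ⊥-elim (ℕ.<-irrefl refl lo<y)
    ... | inj₁ _    = cong inj₂ Range-≡

  Fin-sumFrom↔Range : ∀ (c : ℕ → ℕ) (Q : ℕ → Set) → (∀ y → Fin (c y) ↔ Q y) →
                      ∀ d lo → Fin (sumFrom lo d c) ↔ Range lo d Q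
  Fin-sumFrom↔Range c Q e zero    lo = ↔-trans 0↔⊥ (Range-zero↔ lo Q)
  Fin-sumFrom↔Range c Q e (suc d) lo =
    ↔-trans +↔⊎ (↔-trans (e lo ⊎-↔ Fin-sumFrom↔Range c Q e d (suc lo)) (Range-suc↔ lo d Q))

  Chains : ℕ → ℕ → Set
  Chains k x = Σ (Vec ℕ k) λ v → Chain (x ∷ v)

  ⊤↔Chains-zero : ∀ x → ⊤ ↔ Chains 0 x
  ⊤↔Chains-zero x = mk↔ₛ′ (λ _ → [] , tt) (λ _ → tt) (λ { ([] , tt) → refl }) (λ _ → refl)

  Range↔Chains-suc : ∀ k x → Range (suc x) x (Chains k) ↔ Chains (suc k) x
  Range↔Chains-suc k x = mk↔ₛ′ to from to∘from from∘to
    where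
    ≤2x : ∀ {y} → y < suc x + x → y ≤ 2 * x
    ≤2x {y} p rewrite ℕ.+-identityʳ x = ℕ.≤-pred p

    <1+2x : ∀ {y} → y ≤ 2 * x → y < suc x + x
    <1+2x {y} p rewrite ℕ.+-identityʳ x = s≤s p

    to : Range (suc x) x (Chains k) → Chains (suc k) x
    to (y , (x<y , y<) , (w , ch)) = (y ∷ w) , (x<y , ≤2x y< , ch)

    from : Chains (suc k) x → Range (suc x) x (Chains k)
    from ((y ∷ w) , (x<y , y≤ , ch)) = y , (x<y , <1+2x y≤) , (w , ch)

    to∘from : ∀ r → to (from r) ≡ r
    to∘from ((y ∷ w) , (x<y , y≤ , ch)) rewrite ℕ.≤-irrelevant (≤2x (<1+2x y≤)) y≤ = refl

    from∘to : ∀ s → from (to s) ≡ s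
    from∘to (y , (x<y , y<) , _) rewrite ℕ.<-irrelevant (<1+2x (≤2x y<)) y< = refl

  Fin-chainCount↔Chains : ∀ k x → Fin (chainCount k x) ↔ Chains k x
  Fin-chainCount↔Chains zero    x = ↔-trans 1↔⊤ (⊤↔Chains-zero x)
  Fin-chainCount↔Chains (suc k) x =
    ↔-trans (Fin-sumFrom↔Range (chainCount k) (Chains k) (Fin-chainCount↔Chains k) x (suc x))
            (Range↔Chains-suc k x)

  Fin-tournamentCount↔ : ∀ n → Fin (tournamentCount n) ↔ TournamentSeq n
  Fin-tournamentCount↔ zero    =
    ↔-trans 1↔⊤ (mk↔ₛ′ (λ _ → [] , tt) (λ _ → tt) (λ { ([] , tt) → refl }) (λ _ → refl))
  Fin-tournamentCount↔ (suc m) = ↔-trans (Fin-chainCount↔Chains m 1) (mk↔ₛ′ to from to∘from (λ _ → refl))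
    where
    to : Chains m 1 → TournamentSeq (suc m)
    to (v , ch) = (1 ∷ v) , (refl , ch)

    from : TournamentSeq (suc m) → Chains m 1
    from ((_ ∷ v) , (refl , ch)) = v , ch

    to∘from : ∀ t → to (from t) ≡ t
    to∘from ((_ ∷ v) , (refl , ch)) = refl

module IntegerIdentities where
  import Data.Integer.Tactic.RingSolver as Solver

  [a+b]-[c+d]≡[a-c]+[b-d] : ∀ a b c d → (a ℤ.+ b) ℤ.- (c ℤ.+ d) ≡ (a ℤ.- c) ℤ.+ (b ℤ.- d)
  [a+b]-[c+d]≡[a-c]+[b-d] = Solver.solve-∀

  [a-b]-[c-d]≡[a-c]-[b-d] : ∀ a b c d → (a ℤ.- b) ℤ.- (c ℤ.- d) ≡ (a ℤ.- c) ℤ.- (b ℤ.- d)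
  [a-b]-[c-d]≡[a-c]-[b-d] = Solver.solve-∀

  [a+d]-[b+c]≡[a-b]-[c-d] : ∀ a b c d → (a ℤ.+ d) ℤ.- (b ℤ.+ c) ≡ (a ℤ.- b) ℤ.- (c ℤ.- d)
  [a+d]-[b+c]≡[a-b]-[c-d] = Solver.solve-∀

  [a+b]-a≡b : ∀ a b → (a ℤ.+ b) ℤ.- a ≡ b
  [a+b]-a≡b = Solver.solve-∀

  b+[a-b]≡a : ∀ a b → b ℤ.+ (a ℤ.- b) ≡ a
  b+[a-b]≡a = Solver.solve-∀

module FiniteDifferences where
  open import Data.Integer using (+_)
  open IntegerIdentities
  open Counting

  Seq : Set
  Seq = ℕ → ℤ

  Δ : Seq → Seq
  Δ g x = g (suc x) ℤ.- g x

  Δ^ : ℕ → Seq → Seq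
  Δ^ zero    g = g
  Δ^ (suc d) g = Δ^ d (Δ g)

  record Degree< (d : ℕ) (g : Seq) : Set where
    constructor mkDegree<
    field Δ^-vanishes : ∀ x → Δ^ d g x ≡ 0ℤ
  open Degree< public

  Δ-cong : ∀ {g h} → g ≗ h → Δ g ≗ Δ h
  Δ-cong g≗h x = cong₂ ℤ._-_ (g≗h (suc x)) (g≗h x)

  Δ^-cong : ∀ d {g h} → g ≗ h → Δ^ d g ≗ Δ^ d h
  Δ^-cong zero    g≗h = g≗h
  Δ^-cong (suc d) g≗h = Δ^-cong d (Δ-cong g≗h)

  Δ^-Δ : ∀ d g → Δ^ d (Δ g) ≗ Δ (Δ^ d g)
  Δ^-Δ zero    g x = refl
  Δ^-Δ (suc d) g   = Δ^-Δ d (Δ g)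

  Δ^-∘suc : ∀ d g → Δ^ d (g ∘ suc) ≗ Δ^ d g ∘ suc
  Δ^-∘suc zero    g x = refl
  Δ^-∘suc (suc d) g   = Δ^-∘suc d (Δ g)

  Δ^-+ : ∀ d g h → Δ^ d (λ y → g y ℤ.+ h y) ≗ (λ y → Δ^ d g y ℤ.+ Δ^ d h y)
  Δ^-+ zero    g h x = refl
  Δ^-+ (suc d) g h x = trans (Δ^-cong d Δ-+ x) (Δ^-+ d (Δ g) (Δ h) x)
    where
    Δ-+ : Δ (λ y → g y ℤ.+ h y) ≗ (λ y → Δ g y ℤ.+ Δ h y)
    Δ-+ y = [a+b]-[c+d]≡[a-c]+[b-d] (g (suc y)) (h (suc y)) (g y) (h y)

  Δ^-- : ∀ d g h → Δ^ d (λ y → g y ℤ.- h y) ≗ (λ y → Δ^ d g y ℤ.- Δ^ d h y)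
  Δ^-- zero    g h x = refl
  Δ^-- (suc d) g h x = trans (Δ^-cong d Δ-- x) (Δ^-- d (Δ g) (Δ h) x)
    where
    Δ-- : Δ (λ y → g y ℤ.- h y) ≗ (λ y → Δ g y ℤ.- Δ h y)
    Δ-- y = [a-b]-[c-d]≡[a-c]-[b-d] (g (suc y)) (h (suc y)) (g y) (h y)

  Δ^-suc : ∀ d g x → Δ^ d g (suc x) ≡ Δ^ d g x ℤ.+ Δ^ (suc d) g x
  Δ^-suc d g x =
    trans (sym (b+[a-b]≡a (Δ^ d g (suc x)) (Δ^ d g x))) (cong (λ z → Δ^ d g x ℤ.+ z) (sym (Δ^-Δ d g x)))

  Degree<-Δ : ∀ d {g} → Degree< (suc d) g → Degree< d (Δ g)
  Degree<-Δ d p = mkDegree< (Δ^-vanishes p)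

  Δ-Degree<⇒Degree< : ∀ d {g} → Degree< d (Δ g) → Degree< (suc d) g
  Δ-Degree<⇒Degree< d p = mkDegree< (Δ^-vanishes p)

  Degree<-cong : ∀ d {g h} → g ≗ h → Degree< d g → Degree< d h
  Degree<-cong d g≗h p = mkDegree< λ x → trans (sym (Δ^-cong d g≗h x)) (Δ^-vanishes p x)

  Degree<-+ : ∀ d {g h} → Degree< d g → Degree< d h → Degree< d (λ y → g y ℤ.+ h y)
  Degree<-+ d {g} {h} p q = mkDegree< λ x →
    trans (Δ^-+ d g h x) (cong₂ ℤ._+_ (Δ^-vanishes p x) (Δ^-vanishes q x))

  Degree<-- : ∀ d {g h} → Degree< d g → Degree< d h → Degree< d (λ y → g y ℤ.- h y)
  Degree<-- d {g} {h} p q = mkDegree< λ x →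
    trans (Δ^-- d g h x) (cong₂ ℤ._-_ (Δ^-vanishes p x) (Δ^-vanishes q x))

  Degree<-∘suc : ∀ d {g} → Degree< d g → Degree< d (g ∘ suc)
  Degree<-∘suc d {g} p = mkDegree< λ x → trans (Δ^-∘suc d g x) (Δ^-vanishes p (suc x))

  Degree<-suc : ∀ d {g} → Degree< d g → Degree< (suc d) g
  Degree<-suc d {g} p = mkDegree< λ x →
    trans (Δ^-Δ d g x) (cong₂ ℤ._-_ (Δ^-vanishes p (suc x)) (Δ^-vanishes p x))

  Degree<-mono : ∀ {d e g} → d ≤ e → Degree< d g → Degree< e g
  Degree<-mono d≤e = mono′ (ℕ.≤⇒≤′ d≤e)
    where
    mono′ : ∀ {d e g} → d ≤′ e → Degree< d g → Degree< e g
    mono′ ≤′-refl          p = p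
    mono′ (≤′-step d≤′e) p = Degree<-suc _ (mono′ d≤′e p)

  Degree<-double : ∀ d {g} → Degree< d g → Degree< d (λ y → g (y + y))
  Degree<-double zero    p = mkDegree< λ x → Δ^-vanishes p (x + x)
  Degree<-double (suc d) {g} p =
    Δ-Degree<⇒Degree< d (Degree<-cong d Δ-double
      (Degree<-double d (Degree<-+ d (Degree<-∘suc d (Degree<-Δ d p)) (Degree<-Δ d p))))
    where
    Δ-double : (λ y → Δ g (suc (y + y)) ℤ.+ Δ g (y + y)) ≗ Δ (λ y → g (y + y))
    Δ-double y rewrite ℕ.+-suc y y = ℤ.+-minus-telescope (g (suc (suc (y + y)))) (g (suc (y + y))) (g (y + y))

  partialSum : Seq → Seq
  partialSum g zero    = 0ℤ
  partialSum g (suc x) = partialSum g x ℤ.+ g x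

  Degree<-partialSum : ∀ d {g} → Degree< d g → Degree< (suc d) (partialSum g)
  Degree<-partialSum d {g} p =
    Δ-Degree<⇒Degree< d (Degree<-cong d (λ x → sym ([a+b]-a≡b (partialSum g x) (g x))) p)

  chainCountℤ : ℕ → Seq
  chainCountℤ k x = + chainCount k x

  partialSum-chainCount : ∀ k y → partialSum (chainCountℤ k) y ≡ + chainCountBelow k y
  partialSum-chainCount k zero    = refl
  partialSum-chainCount k (suc y) = begin
    partialSum (chainCountℤ k) y ℤ.+ + chainCount k y ≡⟨ cong (ℤ._+ + chainCount k y) (partialSum-chainCount k y) ⟩
    + chainCountBelow k y ℤ.+ + chainCount k y         ≡⟨ ℤ.pos-+ (chainCountBelow k y) (chainCount k y) ⟨
    + (chainCountBelow k y + chainCount k y)          ≡⟨ cong +_ (chainCountBelow-suc k y) ⟨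
    + chainCountBelow k (suc y)                       ∎
    where open ≡-Reasoning

  chainCount-Degree< : ∀ k → Degree< (suc k) (chainCountℤ k)
  chainCount-Degree< zero    = mkDegree< λ x → refl
  chainCount-Degree< (suc k) =
    Degree<-cong (2 + k) chainCount-suc (Degree<-- (2 + k) (Degree<-double (2 + k) below-suc) below-suc)
    where
    below-suc : Degree< (2 + k) (partialSum (chainCountℤ k) ∘ suc)
    below-suc = Degree<-∘suc (2 + k) (Degree<-partialSum (suc k) (chainCount-Degree< k))

    chainCount-suc : (λ x → partialSum (chainCountℤ k) (suc (x + x)) ℤ.- partialSum (chainCountℤ k) (suc x))
                     ≗ chainCountℤ (suc k)
    chainCount-suc x = begin
      partialSum (chainCountℤ k) (suc (x + x)) ℤ.- partialSum (chainCountℤ k) (suc x)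
        ≡⟨ cong₂ ℤ._-_ (partialSum-chainCount k (suc x + x)) (partialSum-chainCount k (suc x)) ⟩
      + chainCountBelow k (suc x + x) ℤ.- + chainCountBelow k (suc x)
        ≡⟨ cong (λ z → + z ℤ.- + chainCountBelow k (suc x)) (chainCountBelow-double k x) ⟩
      + (chainCountBelow k (suc x) + chainCount (suc k) x) ℤ.- + chainCountBelow k (suc x)
        ≡⟨ cong (ℤ._- + chainCountBelow k (suc x)) (ℤ.pos-+ (chainCountBelow k (suc x)) (chainCount (suc k) x)) ⟩
      (+ chainCountBelow k (suc x) ℤ.+ chainCountℤ (suc k) x) ℤ.- + chainCountBelow k (suc x)
        ≡⟨ [a+b]-a≡b (+ chainCountBelow k (suc x)) (chainCountℤ (suc k) x) ⟩
      chainCountℤ (suc k) x ∎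
      where open ≡-Reasoning

module Machine where
  open import Data.List using (List; []; _∷_; _++_; length; lookup)
  open import Data.Fin using (fromℕ<)
  open import Data.Maybe using (just)
  open import Data.Nat.Logarithm using (⌈log₂_⌉; ⌈log₂⌉-mono-≤; ⌈log₂2^n⌉≡n)

  infix 4 _[_]=_
  data _[_]=_ : Program → ℕ → Instr → Set where
    here  : ∀ {i P} → (i ∷ P) [ 0 ]= i
    there : ∀ {i j P p} → P [ p ]= i → (j ∷ P) [ suc p ]= i

  []=⇒<length : ∀ {P p i} → P [ p ]= i → p < length P
  []=⇒<length here      = s≤s z≤n
  []=⇒<length (there a) = s≤s ([]=⇒<length a)

  []=⇒lookup : ∀ {P p i} → P [ p ]= i → (p< : p < length P) → lookup P (fromℕ< p<) ≡ i
  []=⇒lookup here      p<       = refl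
  []=⇒lookup (there a) (s≤s p<) = []=⇒lookup a p<

  step-[]= : ∀ {P p i} m c → P [ p ]= i → step P (cfg p m c) ≡ exec i (cfg p m c)
  step-[]= {P} {p} m c a with p <? length P
  ... | yes p< = cong (λ i → exec i (cfg p m c)) ([]=⇒lookup a p<)
  ... | no  p≮ = ⊥-elim (p≮ ([]=⇒<length a))

  step-length : ∀ P m c → step P (cfg (length P) m c) ≡ halted m c
  step-length P m c with length P <? length P
  ... | yes p< = ⊥-elim (ℕ.<-irrefl refl p<)
  ... | no  _  = refl

  Contains : Program → ℕ → List Instr → Set
  Contains P o code = ∀ {j i} → code [ j ]= i → P [ o + j ]= i

  Contains-++ˡ : ∀ {P o} xs ys → Contains P o (xs ++ ys) → Contains P o xs
  Contains-++ˡ {P} {o} xs ys h a = h (inject xs a)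
    where
    inject : ∀ xs {j i} → xs [ j ]= i → (xs ++ ys) [ j ]= i
    inject (_ ∷ _)  here      = here
    inject (_ ∷ xs) (there a) = there (inject xs a)

  Contains-++ʳ : ∀ {P o} xs ys → Contains P o (xs ++ ys) → Contains P (o + length xs) ys
  Contains-++ʳ {P} {o} xs ys h {j} {i} a =
    subst (λ q → P [ q ]= i) (sym (ℕ.+-assoc o (length xs) j)) (h (raise xs a))
    where
    raise : ∀ xs {j i} → ys [ j ]= i → (xs ++ ys) [ length xs + j ]= i
    raise []       a = a
    raise (_ ∷ xs) a = there (raise xs a)

  Contains-∷ : ∀ {P o} x xs → Contains P o (x ∷ xs) → P [ o ]= x × Contains P (suc o) xs
  Contains-∷ {P} {o} x xs h =
    subst (λ q → P [ q ]= x) (ℕ.+-identityʳ o) (h here) ,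
    λ {j} {i} a → subst (λ q → P [ q ]= i) (ℕ.+-suc o j) (h (there a))

  record _⊢_⟶_ (P : Program) (κ κ′ : Config) : Set where
    constructor step≡
    field steps : step P κ ≡ running κ′

  Reach : Program → Config → Config → Set
  Reach P = Star (P ⊢_⟶_)

  run-halted : ∀ P κ {m c} → step P κ ≡ halted m c → run P 1 κ ≡ just (m , c)
  run-halted P κ halts rewrite halts = refl

  run-running : ∀ P κ {κ′} fuel → step P κ ≡ running κ′ → run P (suc fuel) κ ≡ run P fuel κ′
  run-running P κ fuel steps rewrite steps = refl

  Reach⇒run : ∀ {P κ p m c} → Reach P κ (cfg p m c) → step P (cfg p m c) ≡ halted m c →
              Σ ℕ λ fuel → run P fuel κ ≡ just (m , c)
  Reach⇒run {P} {κ} ε                      halts = 1 , run-halted P κ halts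
  Reach⇒run {P} (_◅_ {i = κ} (step≡ steps) reach) halts with Reach⇒run reach halts
  ... | fuel , runs = suc fuel , trans (run-running P κ fuel steps) runs

  Reach⇒Computes : ∀ {P n m c out bound} → Reach P (initial n) (cfg (length P) m c) → m 0 ≡ out → c ≤ bound →
                   Computes P n out bound
  Reach⇒Computes {P} {m = m} {c} reach out≡ c≤ with Reach⇒run reach (step-length P m c)
  ... | fuel , runs = fuel , m , c , runs , out≡ , c≤

  addCost : ℕ → Step → Step
  addCost j (halted m c)           = halted m (j + c)
  addCost j (running (cfg p m c)) = running (cfg p m (j + c))

  exec-addCost : ∀ j i p m c → exec i (cfg p m (j + c)) ≡ addCost j (exec i (cfg p m c))
  exec-addCost j (const d k) p m c = cong (running ∘ cfg (suc p) _) (ℕ.+-assoc j c _)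
  exec-addCost j (add d a b) p m c = cong (running ∘ cfg (suc p) _) (ℕ.+-assoc j c _)
  exec-addCost j (sub d a b) p m c = cong (running ∘ cfg (suc p) _) (ℕ.+-assoc j c _)
  exec-addCost j (mul d a b) p m c = cong (running ∘ cfg (suc p) _) (ℕ.+-assoc j c _)
  exec-addCost j (load d a)  p m c = cong (running ∘ cfg (suc p) _) (ℕ.+-assoc j c _)
  exec-addCost j (store a s) p m c = cong (running ∘ cfg (suc p) _) (ℕ.+-assoc j c _)
  exec-addCost j (jz r l)    p m c with m r
  ... | zero  = cong (running ∘ cfg l m) (sym (ℕ.+-suc j c))
  ... | suc _ = cong (running ∘ cfg (suc p) m) (sym (ℕ.+-suc j c))
  exec-addCost j (jmp l)     p m c = cong (running ∘ cfg l m) (sym (ℕ.+-suc j c))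
  exec-addCost j halt        p m c = refl

  step-addCost : ∀ P j p m c → step P (cfg p m (j + c)) ≡ addCost j (step P (cfg p m c))
  step-addCost P j p m c with p <? length P
  ... | yes p< = exec-addCost j (lookup P (fromℕ< p<)) p m c
  ... | no  _  = refl

  Reach-addCost : ∀ {P p m c p′ m′ c′} j → Reach P (cfg p m c) (cfg p′ m′ c′) →
                  Reach P (cfg p m (j + c)) (cfg p′ m′ (j + c′))
  Reach-addCost j ε = ε
  Reach-addCost {P} {p} {m} {c} j (_◅_ {j = cfg _ _ _} (step≡ s) r) =
    step≡ (trans (step-addCost P j p m c) (cong (addCost j) s)) ◅ Reach-addCost j r

  Reach-++ : ∀ {P p m p₁ m₁ c₁ p₂ m₂ c₂} → Reach P (cfg p m 0) (cfg p₁ m₁ c₁) →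
             Reach P (cfg p₁ m₁ 0) (cfg p₂ m₂ c₂) → Reach P (cfg p m 0) (cfg p₂ m₂ (c₁ + c₂))
  Reach-++ {P} {p₁ = p₁} {m₁} {c₁} {p₂} {m₂} {c₂} r q =
    r ◅◅ subst (λ c → Reach P (cfg p₁ m₁ c) (cfg p₂ m₂ (c₁ + c₂))) (ℕ.+-identityʳ c₁)
               (Reach-addCost c₁ q)

  Reach-exec : ∀ {P p i m p′ m′ c′} → P [ p ]= i → exec i (cfg p m 0) ≡ running (cfg p′ m′ c′) →
               Reach P (cfg p m 0) (cfg p′ m′ c′)
  Reach-exec {m = m} a e = step≡ (trans (step-[]= m 0 a) e) ◅ ε

  exec-jz-zero : ∀ {r l p m c} → m r ≡ 0 → exec (jz r l) (cfg p m c) ≡ running (cfg l m (suc c))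
  exec-jz-zero m≡0 rewrite m≡0 = refl

  exec-jz-suc : ∀ {r l p m c z} → m r ≡ suc z → exec (jz r l) (cfg p m c) ≡ running (cfg (suc p) m (suc c))
  exec-jz-suc m≡suc rewrite m≡suc = refl

  update-same : ∀ m i v → update m i v i ≡ v
  update-same m i v with i ≟ i
  ... | yes _  = refl
  ... | no i≢i = ⊥-elim (i≢i refl)

  update-other : ∀ m i v j → ¬ j ≡ i → update m i v j ≡ m j
  update-other m i v j j≢i with j ≟ i
  ... | yes j≡i = ⊥-elim (j≢i j≡i)
  ... | no  _   = refl

  update-cong : ∀ m m′ d v v′ r → m r ≡ m′ r → v ≡ v′ → update m d v r ≡ update m′ d v′ r
  update-cong m m′ d v v′ r m≡ v≡ with r ≟ d
  ... | yes _ = v≡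
  ... | no  _ = m≡

  sz-<2^ : ∀ {v e} → v < 2 ^ e → sz v ≤ suc e
  sz-<2^ {v} {e} v< = s≤s (subst (⌈log₂ suc v ⌉ ≤_) (⌈log₂2^n⌉≡n e) (⌈log₂⌉-mono-≤ v<))

module StraightLine where
  open import Data.List using (List; []; _∷_; _++_; length)
  open import Data.List.Relation.Unary.All using (All; []; _∷_)
  open Machine

  Straight : Instr → Set
  Straight (jz _ _) = ⊥
  Straight (jmp _)  = ⊥
  Straight halt     = ⊥
  Straight _        = ⊤

  effect : Instr → Memory → Memory
  effect (const d k) m = update m d k
  effect (add d a b) m = update m d (m a + m b)
  effect (sub d a b) m = update m d (m a ∸ m b)
  effect (mul d a b) m = update m d (m a * m b)
  effect (load d a)  m = update m d (m (m a))
  effect (store a s) m = update m (m a) (m s)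
  effect _           m = m

  cost : Instr → Memory → ℕ
  cost (const d k) m = sz k
  cost (add d a b) m = sz (m a) + sz (m b)
  cost (sub d a b) m = sz (m a) + sz (m b)
  cost (mul d a b) m = sz (m a) * sz (m b)
  cost (load d a)  m = sz (m a) + sz (m (m a))
  cost (store a s) m = sz (m a) + sz (m s)
  cost _           m = 0

  exec-straight : ∀ {i} p m c → Straight i → exec i (cfg p m c) ≡ running (cfg (suc p) (effect i m) (c + cost i m))
  exec-straight {const d k} p m c _ = refl
  exec-straight {add d a b} p m c _ = refl
  exec-straight {sub d a b} p m c _ = refl
  exec-straight {mul d a b} p m c _ = refl
  exec-straight {load d a}  p m c _ = refl
  exec-straight {store a s} p m c _ = refl

  effects : List Instr → Memory → Memory
  effects []       m = m
  effects (i ∷ is) m = effects is (effect i m)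

  costs : List Instr → Memory → ℕ
  costs []       m = 0
  costs (i ∷ is) m = cost i m + costs is (effect i m)

  Reach-straight : ∀ {P o is} m → All Straight is → Contains P o is →
                   Reach P (cfg o m 0) (cfg (o + length is) (effects is m) (costs is m))
  Reach-straight {P} {o} {[]}     m []       _   rewrite ℕ.+-identityʳ o = ε
  Reach-straight {P} {o} {i ∷ is} m (s ∷ ss) has =
    subst (λ q → Reach P (cfg o m 0) (cfg q (effects is (effect i m)) (cost i m + costs is (effect i m))))
          (sym (ℕ.+-suc o (length is)))
          (Reach-++ (Reach-exec (proj₁ (Contains-∷ i is has)) (exec-straight o m 0 s))
                    (Reach-straight (effect i m) ss (proj₂ (Contains-∷ i is has))))

  EachCost≤ : ℕ → List Instr → Memory → Set
  EachCost≤ B []       m = ⊤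
  EachCost≤ B (i ∷ is) m = cost i m ≤ B × EachCost≤ B is (effect i m)

  EachCost≤-++ : ∀ {B} xs ys m → EachCost≤ B xs m → EachCost≤ B ys (effects xs m) → EachCost≤ B (xs ++ ys) m
  EachCost≤-++ []       ys m _          q = q
  EachCost≤-++ (x ∷ xs) ys m (c≤ , cs) q = c≤ , EachCost≤-++ xs ys (effect x m) cs q

  costs≤ : ∀ {B} is {m} → EachCost≤ B is m → costs is m ≤ length is * B
  costs≤ []       _          = z≤n
  costs≤ (i ∷ is) (c≤ , cs) = ℕ.+-mono-≤ c≤ (costs≤ is cs)

module WhileLanguage where
  open import Data.Bool using (Bool; _∧_)
  open import Data.List using (List; []; _∷_)
  open import Data.List.NonEmpty using (List⁺; _∷_)

  infix 6 _≔#_ _≔_+_ _≔_∸_ _≔_[_] _[_]≔_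
  data Atom : Set where
    _≔#_   : (d k : ℕ) → Atom
    _≔_+_  : (d a b : ℕ) → Atom
    _≔_∸_  : (d a b : ℕ) → Atom
    _≔_[_] : (d t i : ℕ) → Atom
    _[_]≔_ : (t i s : ℕ) → Atom

  infixr 4 _⨾_
  infix 5 while_loop_
  data Cmd : Set where
    atom      : Atom → Cmd
    _⨾_       : Cmd → Cmd → Cmd
    while_loop_ : ℕ → Cmd → Cmd

  atoms : Atom → List Atom → Cmd
  atoms a []       = atom a
  atoms a (b ∷ as) = atom a ⨾ atoms b as

  block : List⁺ Atom → Cmd
  block (a ∷ as) = atoms a as

  record State : Set where
    constructor st
    field
      reg : Memory
      arr : ℕ → Memory
  open State public

  updateArray : (ℕ → Memory) → ℕ → ℕ → ℕ → ℕ → Memory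
  updateArray a t i v u with u ≟ t
  ... | yes _ = update (a u) i v
  ... | no  _ = a u

  ⟦_⟧ : Atom → State → State
  ⟦ d ≔# k      ⟧ (st s a) = st (update s d k) a
  ⟦ d ≔ x + y   ⟧ (st s a) = st (update s d (s x + s y)) a
  ⟦ d ≔ x ∸ y   ⟧ (st s a) = st (update s d (s x ∸ s y)) a
  ⟦ d ≔ t [ i ] ⟧ (st s a) = st (update s d (a t (s i))) a
  ⟦ t [ i ]≔ v  ⟧ (st s a) = st s (updateArray a t (s i) (s v))

  ⟦_⟧* : List Atom → State → State
  ⟦ []     ⟧* σ = σ
  ⟦ a ∷ as ⟧* σ = ⟦ as ⟧* (⟦ a ⟧ σ)

  Fits : ℕ → Atom → State → Set
  Fits E (d ≔# k)      σ = k < 2 ^ E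
  Fits E (d ≔ x + y)   σ = reg σ x < 2 ^ E × reg σ y < 2 ^ E
  Fits E (d ≔ x ∸ y)   σ = reg σ x < 2 ^ E × reg σ y < 2 ^ E
  Fits E (d ≔ t [ i ]) σ = reg σ i < 2 ^ E × arr σ t (reg σ i) < 2 ^ E
  Fits E (t [ i ]≔ v)  σ = reg σ i < 2 ^ E × reg σ v < 2 ^ E

  AllFit : ℕ → List Atom → State → Set
  AllFit E []       σ = ⊤
  AllFit E (a ∷ as) σ = Fits E a σ × AllFit E as (⟦ a ⟧ σ)

  data Exec (E : ℕ) : Cmd → State → ℕ → State → Set where
    atom    : ∀ {a σ} → Fits E a σ → Exec E (atom a) σ 1 (⟦ a ⟧ σ)
    _⨾_     : ∀ {c₁ c₂ σ σ₁ σ₂ t₁ t₂} → Exec E c₁ σ t₁ σ₁ → Exec E c₂ σ₁ t₂ σ₂ →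
              Exec E (c₁ ⨾ c₂) σ (t₁ + t₂) σ₂
    exit    : ∀ {r c σ} → reg σ r ≡ 0 → Exec E (while r loop c) σ 1 σ
    iterate : ∀ {r c σ σ₁ σ₂ t₁ t₂ z} → reg σ r ≡ suc z → Exec E c σ t₁ σ₁ →
              Exec E (while r loop c) σ₁ t₂ σ₂ → Exec E (while r loop c) σ (suc (t₁ + suc t₂)) σ₂

  wfAtom : Atom → Bool
  wfAtom (d ≔# k)      = d <ᵇ 14
  wfAtom (d ≔ x + y)   = (d <ᵇ 14) ∧ (x <ᵇ 14) ∧ (y <ᵇ 14)
  wfAtom (d ≔ x ∸ y)   = (d <ᵇ 14) ∧ (x <ᵇ 14) ∧ (y <ᵇ 14)
  wfAtom (d ≔ t [ i ]) = (d <ᵇ 14) ∧ (t <ᵇ 4) ∧ (i <ᵇ 14)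
  wfAtom (t [ i ]≔ v)  = (t <ᵇ 4) ∧ (i <ᵇ 14) ∧ (v <ᵇ 14)

  wf : Cmd → Bool
  wf (atom a)        = wfAtom a
  wf (c₁ ⨾ c₂)       = wf c₁ ∧ wf c₂
  wf (while r loop c) = (r <ᵇ 14) ∧ wf c

module Compilation where
  open import Data.Bool using (T; _∧_)
  open import Data.Bool.Properties using (T-∧)
  open import Data.List using (List; []; _∷_; _++_; length)
  open import Data.List.Properties using (length-++)
  open import Data.List.Relation.Unary.All using (All; []; _∷_)
  open import Function.Bundles using (Equivalence)
  open import Data.Nat.Tactic.RingSolver using (solve-∀)
  open Machine
  open StraightLine
  open WhileLanguage

  -- Cell x of array t < 4 lives at 16 + 4x + t; registers 14 and 15 are scratch for computing this address.
  address : ℕ → ℕ → ℕ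
  address t x = 16 + (x + x + (x + x) + t)

  addressCode : ℕ → ℕ → List Instr
  addressCode t i = add 15 i i ∷ add 15 15 15 ∷ const 14 t ∷ add 15 15 14 ∷ const 14 16 ∷ add 15 14 15 ∷ []

  compileAtom : Atom → List Instr
  compileAtom (d ≔# k)      = const d k ∷ []
  compileAtom (d ≔ x + y)   = add d x y ∷ []
  compileAtom (d ≔ x ∸ y)   = sub d x y ∷ []
  compileAtom (d ≔ t [ i ]) = addressCode t i ++ load d 15 ∷ []
  compileAtom (t [ i ]≔ v)  = addressCode t i ++ store 15 v ∷ []

  compileAtom-straight : ∀ a → All Straight (compileAtom a)
  compileAtom-straight (d ≔# k)      = tt ∷ []
  compileAtom-straight (d ≔ x + y)   = tt ∷ []
  compileAtom-straight (d ≔ x ∸ y)   = tt ∷ []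
  compileAtom-straight (d ≔ t [ i ]) = tt ∷ tt ∷ tt ∷ tt ∷ tt ∷ tt ∷ tt ∷ []
  compileAtom-straight (t [ i ]≔ v)  = tt ∷ tt ∷ tt ∷ tt ∷ tt ∷ tt ∷ tt ∷ []

  length-compileAtom : ∀ a → length (compileAtom a) ≤ 7
  length-compileAtom (d ≔# k)      = s≤s z≤n
  length-compileAtom (d ≔ x + y)   = s≤s z≤n
  length-compileAtom (d ≔ x ∸ y)   = s≤s z≤n
  length-compileAtom (d ≔ t [ i ]) = ℕ.≤-refl
  length-compileAtom (t [ i ]≔ v)  = ℕ.≤-refl

  size : Cmd → ℕ
  size (atom a)         = length (compileAtom a)
  size (c₁ ⨾ c₂)        = size c₁ + size c₂
  size (while r loop c) = suc (size c + 1)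

  compile : ℕ → Cmd → List Instr
  compile o (atom a)         = compileAtom a
  compile o (c₁ ⨾ c₂)        = compile o c₁ ++ compile (o + size c₁) c₂
  compile o (while r loop c) = jz r (o + size (while r loop c)) ∷ (compile (suc o) c ++ jmp o ∷ [])

  length-compile : ∀ o c → length (compile o c) ≡ size c
  length-compile o (atom a)         = refl
  length-compile o (c₁ ⨾ c₂)        =
    trans (length-++ (compile o c₁)) (cong₂ _+_ (length-compile o c₁) (length-compile (o + size c₁) c₂))
  length-compile o (while r loop c) =
    cong suc (trans (length-++ (compile (suc o) c)) (cong (_+ 1) (length-compile (suc o) c)))

  Represents : Memory → State → Set
  Represents m σ = (∀ r → r < 14 → m r ≡ reg σ r) × (∀ t x → t < 4 → m (address t x) ≡ arr σ t x)

  address-≢ : ∀ {t x r} → r < 14 → ¬ address t x ≡ r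
  address-≢ r<14 a≡r =
    ℕ.<⇒≱ (ℕ.<-≤-trans r<14 (ℕ.≤ᵇ⇒≤ 14 16 tt)) (subst (16 ≤_) a≡r (ℕ.m≤m+n 16 _))

  4x≡x*4 : ∀ x → x + x + (x + x) ≡ x * 4
  4x≡x*4 = solve-∀

  4x+4≡4*[1+x] : ∀ x → x + x + (x + x) + 4 ≡ 4 * suc x
  4x+4≡4*[1+x] = solve-∀

  *4+-injective : ∀ x y {t u} → t < 4 → u < 4 → x * 4 + t ≡ y * 4 + u → x ≡ y × t ≡ u
  *4+-injective zero    zero    _   _   e    = refl , e
  *4+-injective (suc x) (suc y) t<4 u<4 e with *4+-injective x y t<4 u<4 (ℕ.+-cancelˡ-≡ 4 _ _ e)
  ... | refl , t≡u = refl , t≡u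
  *4+-injective zero    (suc y) {u = u} t<4 _   refl = ⊥-elim (ℕ.<⇒≱ t<4 (ℕ.m≤m+n 4 (y * 4 + u)))
  *4+-injective (suc x) zero    {t = t} _   u<4 refl = ⊥-elim (ℕ.<⇒≱ u<4 (ℕ.m≤m+n 4 (x * 4 + t)))

  address-injective : ∀ {t u x y} → t < 4 → u < 4 → address t x ≡ address u y → t ≡ u × x ≡ y
  address-injective {t} {u} {x} {y} t<4 u<4 e with *4+-injective x y t<4 u<4
    (trans (cong (_+ t) (sym (4x≡x*4 x))) (trans (ℕ.+-cancelˡ-≡ 16 _ _ e) (cong (_+ u) (4x≡x*4 y))))
  ... | x≡y , t≡u = t≡u , x≡y

  update-∘ : ∀ (m : Memory) f → (∀ {x y} → f x ≡ f y → x ≡ y) → ∀ x v y →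
             update m (f x) v (f y) ≡ update (m ∘ f) x v y
  update-∘ m f f-inj x v y with f y ≟ f x | y ≟ x
  ... | yes _  | yes _    = refl
  ... | no  _  | no  _    = refl
  ... | yes e  | no  y≢x  = ⊥-elim (y≢x (f-inj e))
  ... | no  ne | yes refl = ⊥-elim (ne refl)

  Represents-update : ∀ {m s a d v w} → d < 14 → v ≡ w → Represents m (st s a) →
                      Represents (update m d v) (st (update s d w) a)
  Represents-update {m} {s} {d = d} d<14 v≡w (regs , arrs) =
    (λ r r<14 → update-cong m s d _ _ r (regs r r<14) v≡w) ,
    (λ u y u<4 → trans (update-other m d _ (address u y) (address-≢ {u} {y} d<14)) (arrs u y u<4))

  Represents-updateArray : ∀ {m s a t x v} → t < 4 → Represents m (st s a) →
                           Represents (update m (address t x) v) (st s (updateArray a t x v))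
  Represents-updateArray {m} {s} {a} {t} {x} {v} t<4 (regs , arrs) = regs′ , arrs′
    where
    regs′ : ∀ r → r < 14 → update m (address t x) v r ≡ s r
    regs′ r r<14 = trans (update-other m (address t x) v r
                            (λ r≡a → address-≢ {t} {x} r<14 (sym r≡a))) (regs r r<14)

    arrs′ : ∀ u y → u < 4 → update m (address t x) v (address u y) ≡ updateArray a t x v u y
    arrs′ u y u<4 with u ≟ t
    ... | yes refl = trans (update-∘ m (address u) (λ e → proj₂ (address-injective u<4 u<4 e)) x v y)
                           (update-cong (m ∘ address u) (a u) x v v y (arrs u y u<4) refl)
    ... | no  u≢t  = trans (update-other m (address t x) v (address u y)
                             (λ e → u≢t (proj₁ (address-injective {u} {t} {y} {x} u<4 t<4 e)))) (arrs u y u<4)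

  addressCode-reg : ∀ t i m r → r < 14 → effects (addressCode t i) m r ≡ m r
  addressCode-reg t i m r r<14 =
    trans (update-other _ 15 _ r r≢15) (trans (update-other _ 14 _ r r≢14) (trans (update-other _ 15 _ r r≢15)
      (trans (update-other _ 14 _ r r≢14) (trans (update-other _ 15 _ r r≢15) (update-other _ 15 _ r r≢15)))))
    where
    r≢14 : ¬ r ≡ 14
    r≢14 refl = ℕ.<-irrefl refl r<14
    r≢15 : ¬ r ≡ 15
    r≢15 refl = ℕ.<-asym r<14 (ℕ.n<1+n 14)

  addressCode-Represents : ∀ t i {m σ} → Represents m σ → Represents (effects (addressCode t i) m) σ
  addressCode-Represents t i {m} (regs , arrs) = (λ r r<14 → trans (addressCode-reg t i m r r<14) (regs r r<14)) , arrs

  split∧ : ∀ {a b} → T (a ∧ b) → T a × T b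
  split∧ {a} {b} = Equivalence.to (T-∧ {a} {b})

  <ᵇ⇒< : ∀ {m n} → T (m <ᵇ n) → m < n
  <ᵇ⇒< {m} {n} = ℕ.<ᵇ⇒< m n

  -- Once the operands of an atom are below 2 ^ E, every operand of its compiled code, including the
  -- computed address, is below 2 ^ (E + 3).
  instrCost : ℕ → ℕ
  instrCost E = 2 * suc (E + 3)

  atomCost : ℕ → ℕ
  atomCost E = 7 * instrCost E

  record Simulated (P : Program) (o : ℕ) (c : Cmd) (m : Memory) (σ′ : State) (B : ℕ) : Set where
    constructor simulated
    field
      {memory}   : Memory
      {spent}    : ℕ
      reach      : Reach P (cfg o m 0) (cfg (o + size c) memory spent)
      represents : Represents memory σ′
      spent≤     : spent ≤ B

  module _ {E : ℕ} (2≤E : 2 ≤ E) where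
    cost₁≤ : ∀ {v} → v < 2 ^ (E + 3) → sz v ≤ instrCost E
    cost₁≤ v< = ℕ.≤-trans (sz-<2^ {e = E + 3} v<) (ℕ.m≤m+n (suc (E + 3)) _)

    cost₂≤ : ∀ {u v} → u < 2 ^ (E + 3) → v < 2 ^ (E + 3) → sz u + sz v ≤ instrCost E
    cost₂≤ {u} {v} u< v< =
      ℕ.+-mono-≤ (sz-<2^ {e = E + 3} u<) (subst (sz v ≤_) (sym (ℕ.+-identityʳ _)) (sz-<2^ {e = E + 3} v<))

    <2^E⇒<2^[E+3] : ∀ {v} → v < 2 ^ E → v < 2 ^ (E + 3)
    <2^E⇒<2^[E+3] v< = ℕ.<-≤-trans v< (ℕ.^-monoʳ-≤ 2 (ℕ.m≤m+n E 3))

    address-< : ∀ {t x} → t < 4 → x < 2 ^ E → address t x < 2 ^ (E + 3)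
    address-< {t} {x} t<4 x< = begin-strict
      16 + (x + x + (x + x) + t)      <⟨ ℕ.+-mono-≤-< 16≤ 4x+t< ⟩
      2 ^ (2 + E) + 2 ^ (2 + E)       ≡⟨ cong (λ z → 2 ^ (2 + E) + z) (sym (ℕ.+-identityʳ _)) ⟩
      2 ^ (3 + E)                     ≡⟨ cong (2 ^_) (ℕ.+-comm 3 E) ⟩
      2 ^ (E + 3)                     ∎
      where
      open ℕ.≤-Reasoning
      16≤ : 16 ≤ 2 ^ (2 + E)
      16≤ = ℕ.^-monoʳ-≤ 2 {4} (s≤s (s≤s 2≤E))
      4x+t< : x + x + (x + x) + t < 2 ^ (2 + E)
      4x+t< = begin-strict
        x + x + (x + x) + t  <⟨ ℕ.+-monoʳ-< _ t<4 ⟩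
        x + x + (x + x) + 4  ≡⟨ 4x+4≡4*[1+x] x ⟩
        4 * suc x            ≤⟨ ℕ.*-monoʳ-≤ 4 x< ⟩
        4 * 2 ^ E            ≡⟨ ℕ.*-assoc 2 2 (2 ^ E) ⟩
        2 ^ (2 + E)          ∎

    addressCode-cost : ∀ t i m → t < 4 → m i < 2 ^ E → EachCost≤ (instrCost E) (addressCode t i) m
    addressCode-cost t i m t<4 x< =
      cost₂≤ (small x≤) (small x≤) , cost₂≤ (small 2x≤) (small 2x≤) , cost₁≤ (small t≤) ,
      cost₂≤ (small 4x≤) (small t≤) , cost₁≤ (small 16≤) , cost₂≤ (small 16≤) (small 4x+t≤) , tt
      where
      x : ℕ
      x = m i
      small : ∀ {v} → v ≤ address t x → v < 2 ^ (E + 3)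
      small v≤ = ℕ.≤-<-trans v≤ (address-< t<4 x<)
      16≤ : 16 ≤ address t x
      16≤ = ℕ.m≤m+n 16 _
      4x+t≤ : x + x + (x + x) + t ≤ address t x
      4x+t≤ = ℕ.m≤n+m _ 16
      t≤ : t ≤ address t x
      t≤ = ℕ.≤-trans (ℕ.m≤n+m t _) 4x+t≤
      4x≤ : x + x + (x + x) ≤ address t x
      4x≤ = ℕ.≤-trans (ℕ.m≤m+n _ t) 4x+t≤
      2x≤ : x + x ≤ address t x
      2x≤ = ℕ.≤-trans (ℕ.m≤m+n _ (x + x)) 4x≤
      x≤ : x ≤ address t x
      x≤ = ℕ.≤-trans (ℕ.m≤m+n x x) 2x≤

    private
      operand : ∀ {u v} → u ≡ v → v < 2 ^ E → u < 2 ^ (E + 3)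
      operand u≡v v< = <2^E⇒<2^[E+3] (subst (_< 2 ^ E) (sym u≡v) v<)

    simulateAtom : ∀ a {σ m} → T (wfAtom a) → Fits E a σ → Represents m σ →
                   Represents (effects (compileAtom a) m) (⟦ a ⟧ σ) × EachCost≤ (instrCost E) (compileAtom a) m
    simulateAtom (d ≔# k) w k< rep = Represents-update (<ᵇ⇒< w) refl rep , cost₁≤ (<2^E⇒<2^[E+3] k<) , tt
    simulateAtom (d ≔ x + y) w (x< , y<) rep@(regs , _) with split∧ w
    ... | wd , wxy with split∧ wxy
    ... | wx , wy =
      Represents-update (<ᵇ⇒< wd) (cong₂ _+_ x≡ y≡) rep , cost₂≤ (operand x≡ x<) (operand y≡ y<) , tt
      where x≡ = regs x (<ᵇ⇒< wx); y≡ = regs y (<ᵇ⇒< wy)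
    simulateAtom (d ≔ x ∸ y) w (x< , y<) rep@(regs , _) with split∧ w
    ... | wd , wxy with split∧ wxy
    ... | wx , wy =
      Represents-update (<ᵇ⇒< wd) (cong₂ _∸_ x≡ y≡) rep , cost₂≤ (operand x≡ x<) (operand y≡ y<) , tt
      where x≡ = regs x (<ᵇ⇒< wx); y≡ = regs y (<ᵇ⇒< wy)
    simulateAtom (d ≔ t [ i ]) {st s a} {m} w (i< , v<) rep@(regs , arrs) with split∧ w
    ... | wd , wti with split∧ wti
    ... | wt , wi = Represents-update (<ᵇ⇒< wd) value (addressCode-Represents t i rep) ,
                    EachCost≤-++ (addressCode t i) (load d 15 ∷ []) m (addressCode-cost t i m t<4 mi<)
                                 (cost₂≤ (address-< t<4 mi<) (operand value v<) , tt)
      where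
      t<4 : t < 4
      t<4 = <ᵇ⇒< wt
      i≡ : m i ≡ s i
      i≡ = regs i (<ᵇ⇒< wi)
      mi< : m i < 2 ^ E
      mi< = subst (_< 2 ^ E) (sym i≡) i<
      value : m (address t (m i)) ≡ a t (s i)
      value = trans (arrs t (m i) t<4) (cong (a t) i≡)
    simulateAtom (t [ i ]≔ v) {st s a} {m} w (i< , v<) rep@(regs , arrs) with split∧ w
    ... | wt , wiv with split∧ wiv
    ... | wi , wv = subst₂ (λ x y → Represents M′ (st s (updateArray a t x y))) i≡ v≡
                      (Represents-updateArray t<4 (addressCode-Represents t i rep)) ,
                    EachCost≤-++ (addressCode t i) (store 15 v ∷ []) m (addressCode-cost t i m t<4 mi<)
                                 (cost₂≤ (address-< t<4 mi<) (operand v≡ v<) , tt)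
      where
      t<4 : t < 4
      t<4 = <ᵇ⇒< wt
      M : Memory
      M = effects (addressCode t i) m
      M′ : Memory
      M′ = update M (address t (m i)) (M v)
      i≡ : m i ≡ s i
      i≡ = regs i (<ᵇ⇒< wi)
      v≡ : M v ≡ s v
      v≡ = trans (addressCode-reg t i m v (<ᵇ⇒< wv)) (regs v (<ᵇ⇒< wv))
      mi< : m i < 2 ^ E
      mi< = subst (_< 2 ^ E) (sym i≡) i<

    compile-correct : ∀ {c σ t σ′} → Exec E c σ t σ′ → T (wf c) → ∀ {P o} → Contains P o (compile o c) →
                      ∀ {m} → Represents m σ → Simulated P o c m σ′ (t * atomCost E)
    compile-correct (atom {a} fits) w {P} {o} has {m} rep with simulateAtom a w fits rep
    ... | rep′ , each≤ =
      simulated (Reach-straight m (compileAtom-straight a) has) rep′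
        (ℕ.≤-trans (costs≤ (compileAtom a) each≤)
                   (subst (length (compileAtom a) * instrCost E ≤_) (sym (ℕ.+-identityʳ (atomCost E)))
                          (ℕ.*-monoˡ-≤ (instrCost E) (length-compileAtom a))))
    compile-correct (_⨾_ {c₁} {c₂} {t₁ = t₁} {t₂} x₁ x₂) w {P} {o} has {m} rep with split∧ {wf c₁} w
    ... | w₁ , w₂ with compile-correct x₁ w₁ (Contains-++ˡ (compile o c₁) (compile (o + size c₁) c₂) has) rep
    ... | simulated {spent = k₁} r₁ rep₁ k₁≤ with compile-correct x₂ w₂ has₂ rep₁
      where
      has₂ : Contains P (o + size c₁) (compile (o + size c₁) c₂)
      has₂ = subst (λ z → Contains P (o + z) (compile (o + size c₁) c₂)) (length-compile o c₁)
                   (Contains-++ʳ (compile o c₁) (compile (o + size c₁) c₂) has)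
    ... | simulated {m₂} {k₂} r₂ rep₂ k₂≤ =
      simulated (subst (λ z → Reach P (cfg o m 0) (cfg z m₂ (k₁ + k₂))) (ℕ.+-assoc o (size c₁) (size c₂))
                       (Reach-++ r₁ r₂))
                rep₂
                (subst (k₁ + k₂ ≤_) (sym (ℕ.*-distribʳ-+ (atomCost E) t₁ t₂)) (ℕ.+-mono-≤ k₁≤ k₂≤))
    compile-correct (exit {r} r≡0) w has rep@(regs , _) =
      simulated (Reach-exec (proj₁ (Contains-∷ _ _ has))
                            (exec-jz-zero (trans (regs r (<ᵇ⇒< (proj₁ (split∧ w)))) r≡0)))
                rep (subst (1 ≤_) (sym (ℕ.+-identityʳ (atomCost E))) (s≤s z≤n))
    compile-correct (iterate {r} {c} {t₁ = t₁} {t₂} r≡suc x₁ x₂) w {P} {o} has {m} rep@(regs , _)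
      with split∧ w | Contains-∷ (jz r (o + size (while r loop c))) (compile (suc o) c ++ jmp o ∷ []) has
    ... | wr , wc | has-jz , has-rest
      with compile-correct x₁ wc (Contains-++ˡ (compile (suc o) c) (jmp o ∷ []) has-rest) rep
    ... | simulated {spent = k₁} r₁ rep₁ k₁≤ with compile-correct x₂ w has rep₁
    ... | simulated {spent = k₂} r₂ rep₂ k₂≤ =
      simulated (Reach-++ (Reach-exec has-jz (exec-jz-suc (trans (regs r (<ᵇ⇒< wr)) r≡suc)))
                          (Reach-++ r₁ (Reach-++ (Reach-exec has-jmp refl) r₂)))
                rep₂
                (subst (1 + (k₁ + (1 + k₂)) ≤_)
                       (cong (atomCost E +_) (sym (ℕ.*-distribʳ-+ (atomCost E) t₁ (suc t₂))))
                       (ℕ.+-mono-≤ 1≤ (ℕ.+-mono-≤ k₁≤ (ℕ.+-mono-≤ 1≤ k₂≤))))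
      where
      1≤ : 1 ≤ atomCost E
      1≤ = s≤s z≤n
      has-jmp : P [ suc o + size c ]= jmp o
      has-jmp = subst (λ q → P [ q ]= jmp o)
                      (trans (ℕ.+-identityʳ (suc o + length (compile (suc o) c)))
                             (cong (suc o +_) (length-compile (suc o) c)))
                      (Contains-++ʳ (compile (suc o) c) (jmp o ∷ []) has-rest here)

module HoareLogic (E : ℕ) where
  open import Data.List using (List; []; _∷_; length)
  open import Data.List.NonEmpty using (List⁺; _∷_; toList)
  open import Data.Nat.Tactic.RingSolver using (solve-∀)
  open WhileLanguage

  record Terminates (c : Cmd) (σ : State) (Post : State → Set) (B : ℕ) : Set where
    constructor terminates
    field
      {final}   : State
      {count}   : ℕ
      execution : Exec E c σ count final
      post      : Post final
      count≤    : count ≤ B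

  Spec : Cmd → (State → Set) → (State → Set) → ℕ → Set
  Spec c Pre Post B = ∀ σ → Pre σ → Terminates c σ Post B

  Spec-⨾ : ∀ {c₁ c₂ P Q R B₁ B₂} → Spec c₁ P Q B₁ → Spec c₂ Q R B₂ → Spec (c₁ ⨾ c₂) P R (B₁ + B₂)
  Spec-⨾ s₁ s₂ σ p with s₁ σ p
  ... | terminates {σ₁} x₁ q t₁≤ with s₂ σ₁ q
  ... | terminates x₂ r t₂≤ = terminates (x₁ ⨾ x₂) r (ℕ.+-mono-≤ t₁≤ t₂≤)

  Spec-weaken : ∀ {c P P′ Q Q′ B B′} → (∀ σ → P σ → P′ σ) → (∀ σ → Q′ σ → Q σ) → B′ ≤ B →
                Spec c P′ Q′ B′ → Spec c P Q B
  Spec-weaken P⇒P′ Q′⇒Q B′≤B s σ p with s σ (P⇒P′ σ p)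
  ... | terminates {σ′} x q t≤ = terminates x (Q′⇒Q σ′ q) (ℕ.≤-trans t≤ B′≤B)

  Spec-while : ∀ r body (I : ℕ → State → Set) B → (∀ c σ → I c σ → reg σ r ≡ c) →
               (∀ c → Spec body (I (suc c)) (I c) B) → ∀ c → Spec (while r loop body) (I c) (I 0) (c * (B + 2) + 1)
  Spec-while r body I B counts step zero    σ i = terminates (exit (counts 0 σ i)) i ℕ.≤-refl
  Spec-while r body I B counts step (suc c) σ i with step c σ i
  ... | terminates {σ₁} {t₁} x₁ i₁ t₁≤ with Spec-while r body I B counts step c σ₁ i₁
  ... | terminates {count = t₂} x₂ i₂ t₂≤ =
    terminates (iterate (counts (suc c) σ i) x₁ x₂) i₂
               (subst (suc (t₁ + suc t₂) ≤_) (unroll B (c * (B + 2))) (s≤s (ℕ.+-mono-≤ t₁≤ (s≤s t₂≤))))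
    where
    unroll : ∀ B X → suc (B + suc (X + 1)) ≡ (B + 2) + X + 1
    unroll = solve-∀
  Exec-atoms : ∀ a as σ → AllFit E (a ∷ as) σ → Exec E (atoms a as) σ (suc (length as)) (⟦ a ∷ as ⟧* σ)
  Exec-atoms a []       σ (fits , _)  = atom fits
  Exec-atoms a (b ∷ bs) σ (fits , fs) = atom fits ⨾ Exec-atoms b bs (⟦ a ⟧ σ) fs

  Spec-block : ∀ as {P Q : State → Set} → (∀ σ → P σ → AllFit E (toList as) σ × Q (⟦ toList as ⟧* σ)) →
               Spec (block as) P Q (length (toList as))
  Spec-block (a ∷ as) h σ p = terminates (Exec-atoms a as σ (proj₁ (h σ p))) (proj₂ (h σ p)) ℕ.≤-refl

  Spec-atom : ∀ a {P Q : State → Set} → (∀ σ → P σ → Fits E a σ × Q (⟦ a ⟧ σ)) → Spec (atom a) P Q 1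
  Spec-atom a h σ p = terminates (atom (proj₁ (h σ p))) (proj₂ (h σ p)) ℕ.≤-refl

module SignedPairs where
  open import Data.Integer using (+_)
  open IntegerIdentities

  -- The pair (p , q) stands for p - q: the machine only has truncated subtraction.
  record Encodes (e : ℕ) (v : ℤ) (p q : ℕ) : Set where
    constructor encodes
    field
      value : p ⊖ q ≡ v
      p≤    : p ≤ 2 ^ e
      q≤    : q ≤ 2 ^ e

  +-≤2^ : ∀ {x y} e → x ≤ 2 ^ e → y ≤ 2 ^ e → x + y ≤ 2 ^ suc e
  +-≤2^ {x} {y} e x≤ y≤ =
    subst (x + y ≤_) (cong (λ z → 2 ^ e + z) (sym (ℕ.+-identityʳ (2 ^ e)))) (ℕ.+-mono-≤ x≤ y≤)

  [a+c]⊖[b+d] : ∀ a b c d → (a + c) ⊖ (b + d) ≡ (a ⊖ b) ℤ.+ (c ⊖ d)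
  [a+c]⊖[b+d] a b c d = begin
    (a + c) ⊖ (b + d)                  ≡⟨ ℤ.[+m]-[+n]≡m⊖n (a + c) (b + d) ⟨
    + (a + c) ℤ.- + (b + d)            ≡⟨ cong₂ ℤ._-_ (ℤ.pos-+ a c) (ℤ.pos-+ b d) ⟩
    (+ a ℤ.+ + c) ℤ.- (+ b ℤ.+ + d)    ≡⟨ [a+b]-[c+d]≡[a-c]+[b-d] (+ a) (+ c) (+ b) (+ d) ⟩
    (+ a ℤ.- + b) ℤ.+ (+ c ℤ.- + d)    ≡⟨ cong₂ ℤ._+_ (ℤ.[+m]-[+n]≡m⊖n a b) (ℤ.[+m]-[+n]≡m⊖n c d) ⟩
    (a ⊖ b) ℤ.+ (c ⊖ d)                ∎
    where open ≡-Reasoning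

  [a+d]⊖[b+c] : ∀ a b c d → (a + d) ⊖ (b + c) ≡ (a ⊖ b) ℤ.- (c ⊖ d)
  [a+d]⊖[b+c] a b c d = begin
    (a + d) ⊖ (b + c)                  ≡⟨ ℤ.[+m]-[+n]≡m⊖n (a + d) (b + c) ⟨
    + (a + d) ℤ.- + (b + c)            ≡⟨ cong₂ ℤ._-_ (ℤ.pos-+ a d) (ℤ.pos-+ b c) ⟩
    (+ a ℤ.+ + d) ℤ.- (+ b ℤ.+ + c)    ≡⟨ [a+d]-[b+c]≡[a-b]-[c-d] (+ a) (+ b) (+ c) (+ d) ⟩
    (+ a ℤ.- + b) ℤ.- (+ c ℤ.- + d)    ≡⟨ cong₂ ℤ._-_ (ℤ.[+m]-[+n]≡m⊖n a b) (ℤ.[+m]-[+n]≡m⊖n c d) ⟩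
    (a ⊖ b) ℤ.- (c ⊖ d)                ∎
    where open ≡-Reasoning

  ⊖≡+⇒∸≡ : ∀ a b {c} → a ⊖ b ≡ + c → a ∸ b ≡ c
  ⊖≡+⇒∸≡ a b {c} a⊖b≡c with ℕ.≤-<-connex b a
  ... | inj₁ b≤a = ℤ.+-injective (trans (sym (ℤ.⊖-≥ b≤a)) a⊖b≡c)
  ... | inj₂ a<b = ⊥-elim (ℕ.<⇒≱ a<b (ℕ.m∸n≡0⇒m≤n (-+≡+⇒≡0 (trans (sym (ℤ.⊖-< a<b)) a⊖b≡c))))
    where
    -+≡+⇒≡0 : ∀ {m} → ℤ.- (+ m) ≡ + c → m ≡ 0
    -+≡+⇒≡0 {zero}  _ = refl
    -+≡+⇒≡0 {suc m} ()

  Encodes-+ : ∀ {e v w p q p′ q′} → Encodes e v p q → Encodes e w p′ q′ →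
              Encodes (suc e) (v ℤ.+ w) (p + p′) (q + q′)
  Encodes-+ {e} {p = p} {q} {p′} {q′} (encodes ≡v p≤ q≤) (encodes ≡w p′≤ q′≤) =
    encodes (trans ([a+c]⊖[b+d] p q p′ q′) (cong₂ ℤ._+_ ≡v ≡w)) (+-≤2^ e p≤ p′≤) (+-≤2^ e q≤ q′≤)

  Encodes-- : ∀ {e v w p q p′ q′} → Encodes e v p q → Encodes e w p′ q′ →
              Encodes (suc e) (v ℤ.- w) (p + q′) (q + p′)
  Encodes-- {e} {p = p} {q} {p′} {q′} (encodes ≡v p≤ q≤) (encodes ≡w p′≤ q′≤) =
    encodes (trans ([a+d]⊖[b+c] p q p′ q′) (cong₂ ℤ._-_ ≡v ≡w)) (+-≤2^ e p≤ q′≤) (+-≤2^ e q≤ p′≤)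

  Encodes-mono : ∀ {e e′ v p q} → e ≤ e′ → Encodes e v p q → Encodes e′ v p q
  Encodes-mono e≤e′ (encodes ≡v p≤ q≤) =
    encodes ≡v (ℕ.≤-trans p≤ (ℕ.^-monoʳ-≤ 2 e≤e′)) (ℕ.≤-trans q≤ (ℕ.^-monoʳ-≤ 2 e≤e′))

  Encodes-+⇒∸ : ∀ {e c p q} → Encodes e (+ c) p q → p ∸ q ≡ c × p ∸ q ≤ 2 ^ e
  Encodes-+⇒∸ {p = p} {q} (encodes ≡c p≤ _) = ⊖≡+⇒∸≡ p q ≡c , ℕ.≤-trans (ℕ.m∸n≤m p q) p≤

module Layout where
  IO ONE LAST LAYER OUTER INNER I J T₁ T₂ T₃ T₄ ACC X : ℕ
  IO    = 0
  ONE   = 1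
  LAST  = 2
  LAYER = 3
  OUTER = 4
  INNER = 5
  I     = 6
  J     = 7
  T₁    = 8
  T₂    = 9
  T₃    = 10
  T₄    = 11
  ACC   = 12
  X     = 13

  POS NEG SUMS : ℕ
  POS  = 0
  NEG  = 1
  SUMS = 2

  open WhileLanguage using (State; reg; arr)
  open Counting using (chainCountBelow)

  Frame : ℕ → ℕ → State → Set
  Frame L c σ = reg σ ONE ≡ 1 × reg σ LAST ≡ L × reg σ LAYER ≡ c

  -- The prefix sums are needed up to 2L + 1.
  steps : ℕ → ℕ
  steps L = L + L + 1 + 1

  -- A layer whose input values are below 2 ^ b only handles numbers below 2 ^ (width L + b).
  width : ℕ → ℕ
  width L = steps L + L

  L≤steps : ∀ L → L ≤ steps L
  L≤steps L = ℕ.≤-trans (ℕ.m≤m+n L L) (ℕ.≤-trans (ℕ.m≤m+n (L + L) 1) (ℕ.m≤m+n (L + L + 1) 1))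

  1+L≤steps : ∀ L → suc L ≤ steps L
  1+L≤steps L = ℕ.≤-trans (s≤s (ℕ.m≤m+n L L))
                          (ℕ.≤-trans (ℕ.≤-reflexive (ℕ.+-comm 1 (L + L))) (ℕ.m≤m+n (L + L + 1) 1))

  L≤width : ∀ L → L ≤ width L
  L≤width L = ℕ.≤-trans (L≤steps L) (ℕ.m≤m+n (steps L) L)

  SumsBelow : ℕ → ℕ → ℕ → State → Set
  SumsBelow k e x σ = ∀ y → y < x → arr σ SUMS y ≡ chainCountBelow k y × arr σ SUMS y ≤ 2 ^ e

module Counters where
  m+1+n≡o⇒m<o : ∀ {m n o} → m + suc n ≡ o → m < o
  m+1+n≡o⇒m<o {m} e = subst (m <_) e (ℕ.m<m+n m (s≤s z≤n))

  m+1+n≡o⇒n<o : ∀ {m n o} → m + suc n ≡ o → n < o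
  m+1+n≡o⇒n<o {m} {n} e = subst (suc n ≤_) e (ℕ.m≤n+m (suc n) m)

  <1+n∧≢⇒< : ∀ {m n} → m < suc n → m ≢ n → m < n
  <1+n∧≢⇒< m<1+n m≢n = ℕ.≤∧≢⇒< (ℕ.≤-pred m<1+n) m≢n

module DifferencePhase where
  open import Data.List using ([]; _∷_)
  open import Data.List.NonEmpty using (List⁺; _∷_; toList)
  open Machine using (update-same; update-other)
  open WhileLanguage
  open FiniteDifferences
  open SignedPairs
  open Layout
  open Counters

  -- Differencing in place from the top index down, after lv rounds cell t holds Δ^(min t lv) g (t ∸ lv).
  diffTable : Seq → ℕ → ℕ → ℤ
  diffTable g lv t = Δ^ (t ⊓ lv) g (t ∸ lv)

  diffTable-zero : ∀ g t → diffTable g 0 t ≡ g t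
  diffTable-zero g t = cong (λ d → Δ^ d g t) (ℕ.⊓-zeroʳ t)

  diffTable-≤ : ∀ g {lv t} → t ≤ lv → diffTable g lv t ≡ Δ^ t g 0
  diffTable-≤ g t≤lv = cong₂ (λ d x → Δ^ d g x) (ℕ.m≤n⇒m⊓n≡m t≤lv) (ℕ.m≤n⇒m∸n≡0 t≤lv)

  diffTable-+ : ∀ g lv x → diffTable g lv (lv + x) ≡ Δ^ lv g x
  diffTable-+ g lv x = cong₂ (λ d y → Δ^ d g y) (ℕ.m≥n⇒m⊓n≡n (ℕ.m≤m+n lv x)) (ℕ.m+n∸m≡n lv x)

  diffTable-suc : ∀ g lv d →
                  diffTable g lv (lv + suc d) ℤ.- diffTable g lv (lv + d) ≡ diffTable g (suc lv) (lv + suc d)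
  diffTable-suc g lv d rewrite diffTable-+ g lv (suc d) | diffTable-+ g lv d | ℕ.+-suc lv d =
    sym (trans (diffTable-+ g (suc lv) d) (Δ^-Δ lv g d))

  diffStepAtoms : List⁺ Atom
  diffStepAtoms = J ≔ I ∸ ONE ∷ T₁ ≔ POS [ I ] ∷ T₂ ≔ NEG [ J ] ∷ T₁ ≔ T₁ + T₂ ∷ T₃ ≔ NEG [ I ] ∷
                  T₄ ≔ POS [ J ] ∷ T₃ ≔ T₃ + T₄ ∷ POS [ I ]≔ T₁ ∷ NEG [ I ]≔ T₃ ∷ I ≔ I ∸ ONE ∷
                  INNER ≔ INNER ∸ ONE ∷ []

  -- There is no register copy: r ≔ s is written r ≔# 0 followed by r ≔ r + s.
  levelStartAtoms differencesStartAtoms : List⁺ Atom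
  levelStartAtoms       = I ≔# 0 ∷ I ≔ I + LAST ∷ INNER ≔# 0 ∷ INNER ≔ INNER + OUTER ∷ []
  differencesStartAtoms = OUTER ≔# 0 ∷ OUTER ≔ OUTER + LAST ∷ []

  diffStep diffLevel differences : Cmd
  diffStep = block diffStepAtoms
  diffLevel = block levelStartAtoms ⨾
              while INNER loop diffStep ⨾
              atom (OUTER ≔ OUTER ∸ ONE)
  differences = block differencesStartAtoms ⨾ while OUTER loop diffLevel

  levelBound differencesBound : ℕ → ℕ
  levelBound L       = 4 + (L * 13 + 1 + 1)
  differencesBound L = 2 + (L * (levelBound L + 2) + 1)

  module Correctness (E L b c : ℕ) (g : Seq)
    (fits  : ∀ {v e} → v ≤ 2 ^ (e + b) → e ≤ L → v < 2 ^ E)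
    (small : ∀ {v} → v ≤ L → v < 2 ^ E) where
    open HoareLogic E

    Cell : ℕ → Memory → Memory → ℕ → Set
    Cell lv P N t = Encodes (lv + b) (diffTable g lv t) (P t) (N t)

    Table : ℕ → State → Set
    Table lv σ = ∀ t → t ≤ L → Cell lv (arr σ POS) (arr σ NEG) t

    Mixed : ℕ → ℕ → Memory → Memory → Set
    Mixed lv i P N = ∀ t → t ≤ L → (i < t → Cell (suc lv) P N t) × (t ≤ i → Cell lv P N t)

    Mixed-step : ∀ P N lv d {i j} → i ≡ lv + suc d → j ≡ lv + d → Mixed lv i P N →
                 Mixed lv j (update P i (P i + N j)) (update N i (N i + P j))
    Mixed-step P N lv d refl refl mixed t t≤L with toSum (t ≟ lv + suc d)
    ... | inj₁ refl = (λ _ → new) , (λ i≤j → ⊥-elim (ℕ.<-irrefl refl (ℕ.≤-<-trans i≤j j<i)))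
      where
      i j : ℕ
      i = lv + suc d
      j = lv + d
      j<i : j < i
      j<i = ℕ.+-monoʳ-< lv (ℕ.n<1+n d)
      new : Cell (suc lv) (update P i (P i + N j)) (update N i (N i + P j)) i
      new rewrite update-same P i (P i + N j) | update-same N i (N i + P j) =
        subst (λ v → Encodes (suc lv + b) v (P i + N j) (N i + P j)) (diffTable-suc g lv d)
          (Encodes-- (proj₂ (mixed i t≤L) ℕ.≤-refl)
                     (proj₂ (mixed j (ℕ.<⇒≤ (ℕ.<-≤-trans j<i t≤L))) (ℕ.<⇒≤ j<i)))
    ... | inj₂ t≢i = (λ j<t → unchanged (suc lv) (proj₁ (mixed t t≤L) (i<t j<t))) ,
                     (λ t≤j → unchanged lv (proj₂ (mixed t t≤L) (ℕ.≤-trans t≤j (ℕ.+-monoʳ-≤ lv (ℕ.n≤1+n d)))))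
      where
      i j : ℕ
      i = lv + suc d
      j = lv + d
      unchanged : ∀ l → Cell l P N t → Cell l (update P i (P i + N j)) (update N i (N i + P j)) t
      unchanged l cell rewrite update-other P i (P i + N j) t t≢i
                             | update-other N i (N i + P j) t t≢i = cell
      i<t : j < t → i < t
      i<t j<t = ℕ.≤∧≢⇒< (subst (_≤ t) (sym (ℕ.+-suc lv d)) j<t) (λ i≡t → t≢i (sym i≡t))

    StepInv : ℕ → ℕ → ℕ → State → Set
    StepInv lv o d σ = Frame L c σ × reg σ OUTER ≡ o × reg σ INNER ≡ d × reg σ I ≡ lv + d × lv + d ≤ L ×
                       Mixed lv (lv + d) (arr σ POS) (arr σ NEG)

    diffStep-spec : ∀ lv o d → Spec diffStep (StepInv lv o (suc d)) (StepInv lv o d) 11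
    diffStep-spec lv o d = Spec-block diffStepAtoms proof
      where
      proof : ∀ σ → StepInv lv o (suc d) σ →
              AllFit E (toList diffStepAtoms) σ × StepInv lv o d (⟦ toList diffStepAtoms ⟧* σ)
      proof (st s a) ((one≡ , last≡ , layer≡) , outer≡ , inner≡ , i≡ , i≤L , mixed) = allFit , post
        where
        j≡ : s I ∸ s ONE ≡ lv + d
        j≡ = trans (cong₂ _∸_ i≡ one≡) (cong (_∸ 1) (ℕ.+-suc lv d))
        j≤L : lv + d ≤ L
        j≤L = ℕ.≤-trans (ℕ.+-monoʳ-≤ lv (ℕ.n≤1+n d)) i≤L
        1+lv≤L : suc lv ≤ L
        1+lv≤L = ℕ.≤-trans (subst (suc lv ≤_) (sym (ℕ.+-suc lv d)) (s≤s (ℕ.m≤m+n lv d))) i≤L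
        mixed′ : Mixed lv (s I) (a POS) (a NEG)
        mixed′ = subst (λ z → Mixed lv z (a POS) (a NEG)) (sym i≡) mixed
        cellI : Cell lv (a POS) (a NEG) (s I)
        cellI = proj₂ (mixed′ (s I) (subst (_≤ L) (sym i≡) i≤L)) ℕ.≤-refl
        cellJ : Cell lv (a POS) (a NEG) (s I ∸ s ONE)
        cellJ = proj₂ (mixed′ (s I ∸ s ONE) (subst (_≤ L) (sym j≡) j≤L)) (ℕ.m∸n≤m (s I) (s ONE))
        new : Encodes (suc lv + b) (diffTable g lv (s I) ℤ.- diffTable g lv (s I ∸ s ONE))
                      (a POS (s I) + a NEG (s I ∸ s ONE)) (a NEG (s I) + a POS (s I ∸ s ONE))
        new = Encodes-- cellI cellJ
        fitsLv : ∀ {v} → v ≤ 2 ^ (lv + b) → v < 2 ^ E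
        fitsLv v≤ = fits v≤ (ℕ.≤-trans (ℕ.n≤1+n lv) 1+lv≤L)
        fitsLv+1 : ∀ {v} → v ≤ 2 ^ (suc lv + b) → v < 2 ^ E
        fitsLv+1 v≤ = fits v≤ 1+lv≤L
        sI : s I < 2 ^ E
        sI = small (subst (_≤ L) (sym i≡) i≤L)
        sJ : s I ∸ s ONE < 2 ^ E
        sJ = small (subst (_≤ L) (sym j≡) j≤L)
        sONE : s ONE < 2 ^ E
        sONE = small (subst (_≤ L) (sym one≡) (ℕ.≤-trans (s≤s z≤n) 1+lv≤L))
        sINNER : s INNER < 2 ^ E
        sINNER = small (subst (_≤ L) (sym inner≡)
                              (ℕ.≤-trans (s≤s (ℕ.m≤n+m d lv)) (subst (_≤ L) (ℕ.+-suc lv d) i≤L)))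
        open Encodes
        allFit : AllFit E (toList diffStepAtoms) (st s a)
        allFit = (sI , sONE) , (sI , fitsLv (p≤ cellI)) , (sJ , fitsLv (q≤ cellJ)) ,
                 (fitsLv (p≤ cellI) , fitsLv (q≤ cellJ)) , (sI , fitsLv (q≤ cellI)) , (sJ , fitsLv (p≤ cellJ)) ,
                 (fitsLv (q≤ cellI) , fitsLv (p≤ cellJ)) , (sI , fitsLv+1 (p≤ new)) , (sI , fitsLv+1 (q≤ new)) ,
                 (sI , sONE) , (sINNER , sONE) , tt
        post : StepInv lv o d (⟦ toList diffStepAtoms ⟧* (st s a))
        post = (one≡ , last≡ , layer≡) , outer≡ , cong₂ _∸_ inner≡ one≡ , j≡ , j≤L ,
               subst (λ z → Mixed lv z (update (a POS) (s I) (a POS (s I) + a NEG (s I ∸ s ONE)))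
                                       (update (a NEG) (s I) (a NEG (s I) + a POS (s I ∸ s ONE)))) j≡
                 (Mixed-step (a POS) (a NEG) lv d i≡ j≡ mixed′)

    diffLoop-spec : ∀ lv o d → Spec (while INNER loop diffStep) (StepInv lv o d) (StepInv lv o 0) (d * (11 + 2) + 1)
    diffLoop-spec lv o =
      Spec-while INNER diffStep (StepInv lv o) 11 (λ d σ (_ , _ , inner≡ , _) → inner≡) (diffStep-spec lv o)

    LevelInv : ℕ → State → Set
    LevelInv o σ = Frame L c σ × reg σ OUTER ≡ o × o ≤ L × Table (L ∸ o) σ

    level-start : ∀ o σ → LevelInv (suc o) σ →
                  AllFit E (toList levelStartAtoms) σ ×
                  StepInv (L ∸ suc o) (suc o) (suc o) (⟦ toList levelStartAtoms ⟧* σ)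
    level-start o (st s a) (frame@(_ , last≡ , _) , outer≡ , o<L , table) =
      (z< , (z< , small (subst (_≤ L) (sym last≡) ℕ.≤-refl)) , z< ,
       (z< , small (subst (_≤ L) (sym outer≡) o<L)) , tt) ,
      frame , outer≡ , outer≡ , trans last≡ (sym L≡) , ℕ.≤-reflexive L≡ ,
      λ t t≤L → (λ L<t → ⊥-elim (ℕ.<⇒≱ L<t (subst (t ≤_) (sym L≡) t≤L))) , (λ _ → table t t≤L)
      where
      z< : 0 < 2 ^ E
      z< = small z≤n
      L≡ : L ∸ suc o + suc o ≡ L
      L≡ = ℕ.m∸n+n≡m o<L

    level-end : ∀ o σ → suc o ≤ L → StepInv (L ∸ suc o) (suc o) 0 σ →
                Fits E (OUTER ≔ OUTER ∸ ONE) σ × LevelInv o (⟦ OUTER ≔ OUTER ∸ ONE ⟧ σ)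
    level-end o (st s a) o<L (frame@(one≡ , _ , _) , outer≡ , _ , _ , _ , mixed) =
      (small (subst (_≤ L) (sym outer≡) o<L) , small (subst (_≤ L) (sym one≡) (ℕ.≤-trans (s≤s z≤n) o<L))) ,
      frame , cong₂ _∸_ outer≡ one≡ , ℕ.<⇒≤ o<L , table
      where
      lv : ℕ
      lv = L ∸ suc o
      1+lv≡ : suc lv ≡ L ∸ o
      1+lv≡ = sym (ℕ.+-∸-assoc 1 o<L)
      table : Table (L ∸ o) (st s a)
      table t t≤L with ℕ.≤-<-connex t lv
      ... | inj₁ t≤lv = subst (λ l → Cell l (a POS) (a NEG) t) 1+lv≡
                              (settled (proj₂ (mixed t t≤L) (subst (t ≤_) (sym (ℕ.+-identityʳ lv)) t≤lv)))
        where
        settled : Cell lv (a POS) (a NEG) t → Cell (suc lv) (a POS) (a NEG) t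
        settled (encodes ≡v p≤ q≤) = Encodes-mono (ℕ.n≤1+n (lv + b))
          (encodes (trans ≡v (trans (diffTable-≤ g t≤lv) (sym (diffTable-≤ g (ℕ.≤-trans t≤lv (ℕ.n≤1+n lv))))))
                   p≤ q≤)
      ... | inj₂ lv<t = subst (λ l → Cell l (a POS) (a NEG) t) 1+lv≡
                              (proj₁ (mixed t t≤L) (subst (_< t) (sym (ℕ.+-identityʳ lv)) lv<t))

    diffLevel-spec : ∀ o → Spec diffLevel (LevelInv (suc o)) (LevelInv o) (levelBound L)
    diffLevel-spec o σ inv@(_ , _ , o<L , _) =
      (Spec-⨾ (Spec-block levelStartAtoms (level-start o))
        (Spec-⨾ (Spec-weaken (λ _ p → p) (λ _ q → q) (ℕ.+-monoˡ-≤ 1 (ℕ.*-monoˡ-≤ 13 o<L))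
                             (diffLoop-spec (L ∸ suc o) (suc o) (suc o)))
                (Spec-atom (OUTER ≔ OUTER ∸ ONE) (λ σ′ → level-end o σ′ o<L)))) σ inv

    differences-spec : Spec differences (λ σ → Frame L c σ × Table 0 σ) (λ σ → Frame L c σ × Table L σ)
                            (differencesBound L)
    differences-spec =
      Spec-⨾ (Spec-block differencesStartAtoms start)
             (Spec-weaken (λ _ p → p) (λ _ (frame , _ , _ , table) → frame , table) ℕ.≤-refl
                          (Spec-while OUTER diffLevel LevelInv (levelBound L) (λ o σ (_ , outer≡ , _) → outer≡)
                                      diffLevel-spec L))
      where
      start : ∀ σ → Frame L c σ × Table 0 σ →
              AllFit E (toList differencesStartAtoms) σ × LevelInv L (⟦ toList differencesStartAtoms ⟧* σ)
      start (st s a) (frame@(_ , last≡ , _) , table) =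
        (small z≤n , (small z≤n , small (subst (_≤ L) (sym last≡) ℕ.≤-refl)) , tt) ,
        frame , last≡ , ℕ.≤-refl , subst (λ l → Table l (st s a)) (sym (ℕ.n∸n≡0 L)) table

module ExtensionPhase where
  open import Data.List using ([]; _∷_)
  open import Data.List.NonEmpty using (List⁺; _∷_; toList)
  open Machine using (update-same; update-other)
  open WhileLanguage
  open Counting
  open FiniteDifferences
  open SignedPairs
  open Layout
  open Counters

  extStepAtoms pointStartAtoms pointEndAtoms extensionStartAtoms : List⁺ Atom
  extStepAtoms = J ≔ I + ONE ∷ T₁ ≔ POS [ I ] ∷ T₂ ≔ POS [ J ] ∷ T₁ ≔ T₁ + T₂ ∷ POS [ I ]≔ T₁ ∷
                 T₁ ≔ NEG [ I ] ∷ T₂ ≔ NEG [ J ] ∷ T₁ ≔ T₁ + T₂ ∷ NEG [ I ]≔ T₁ ∷ I ≔ I + ONE ∷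
                 INNER ≔ INNER ∸ ONE ∷ []
  pointStartAtoms = SUMS [ X ]≔ ACC ∷ I ≔# 0 ∷ T₁ ≔ POS [ I ] ∷ T₂ ≔ NEG [ I ] ∷ T₁ ≔ T₁ ∸ T₂ ∷
                    ACC ≔ ACC + T₁ ∷ INNER ≔# 0 ∷ INNER ≔ INNER + LAST ∷ []
  pointEndAtoms = X ≔ X + ONE ∷ OUTER ≔ OUTER ∸ ONE ∷ []
  extensionStartAtoms = ACC ≔# 0 ∷ X ≔# 0 ∷ OUTER ≔ LAST + LAST ∷ OUTER ≔ OUTER + ONE ∷
                        OUTER ≔ OUTER + ONE ∷ []

  extStep extPoint extension : Cmd
  extStep   = block extStepAtoms
  extPoint  = block pointStartAtoms ⨾ while INNER loop extStep ⨾ block pointEndAtoms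
  extension = block extensionStartAtoms ⨾ while OUTER loop extPoint

  pointBound extensionBound : ℕ → ℕ
  pointBound L     = 8 + ((L * 13 + 1) + 2)
  extensionBound L = 5 + (steps L * (pointBound L + 2) + 1)

  module Correctness (E L b c k : ℕ) (degree : Degree< (suc L) (chainCountℤ k))
    (fits  : ∀ {v e} → v ≤ 2 ^ (e + b) → e ≤ width L → v < 2 ^ E)
    (small : ∀ {v} → v ≤ steps L → v < 2 ^ E) where
    open HoareLogic E
    open Encodes

    f : Seq
    f = chainCountℤ k

    Cell : ℕ → Memory → Memory → ℕ → Set
    Cell x P N t = Encodes (x + L + b) (Δ^ t f x) (P t) (N t)

    Cells : ℕ → State → Set
    Cells x σ = ∀ t → t ≤ L → Cell x (arr σ POS) (arr σ NEG) t

    Mixed : ℕ → ℕ → Memory → Memory → Set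
    Mixed x j P N = ∀ t → t ≤ L → (t < j → Cell (suc x) P N t) × (j ≤ t → Cell x P N t)

    Mixed-step : ∀ P N x j → suc j ≤ L → Mixed x j P N →
                 Mixed x (suc j) (update P j (P j + P (suc j))) (update N j (N j + N (suc j)))
    Mixed-step P N x j j<L mixed t t≤L with toSum (t ≟ j)
    ... | inj₁ refl = (λ _ → new) , (λ 1+t≤t → ⊥-elim (ℕ.<-irrefl refl 1+t≤t))
      where
      new : Cell (suc x) (update P t (P t + P (suc t))) (update N t (N t + N (suc t))) t
      new rewrite update-same P t (P t + P (suc t)) | update-same N t (N t + N (suc t)) =
        subst (λ v → Encodes (suc x + L + b) v (P t + P (suc t)) (N t + N (suc t))) (sym (Δ^-suc t f x))
          (Encodes-+ (proj₂ (mixed t t≤L) ℕ.≤-refl) (proj₂ (mixed (suc t) j<L) (ℕ.n≤1+n t)))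
    ... | inj₂ t≢j = (λ t<1+j → unchanged (suc x) (proj₁ (mixed t t≤L) (<1+n∧≢⇒< t<1+j t≢j))) ,
                     (λ 1+j≤t → unchanged x (proj₂ (mixed t t≤L) (ℕ.<⇒≤ 1+j≤t)))
      where
      unchanged : ∀ y → Cell y P N t → Cell y (update P j (P j + P (suc j))) (update N j (N j + N (suc j))) t
      unchanged y cell rewrite update-other P j (P j + P (suc j)) t t≢j
                             | update-other N j (N j + N (suc j)) t t≢j = cell

    Point : ℕ → ℕ → State → Set
    Point x o σ = Frame L c σ × reg σ OUTER ≡ o × reg σ X ≡ x × reg σ ACC ≡ chainCountBelow k x ×
                  chainCountBelow k x ≤ 2 ^ (x + L + b) × Cells x σ × SumsBelow k (width L + b) x σ

    ExtInv : ℕ → State → Set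
    ExtInv o σ = Σ ℕ λ x → x + o ≡ steps L × Point x o σ

    Advancing : ℕ → ℕ → State → Set
    Advancing x o σ = x + suc o ≡ steps L × Frame L c σ × reg σ OUTER ≡ suc o × reg σ X ≡ x ×
                      reg σ ACC ≡ chainCountBelow k (suc x) × chainCountBelow k (suc x) ≤ 2 ^ (suc x + L + b) ×
                      SumsBelow k (width L + b) (suc x) σ

    StepInv : ℕ → ℕ → ℕ → State → Set
    StepInv x o d σ = Advancing x o σ × reg σ INNER ≡ d ×
                      Σ ℕ λ j → j + d ≡ L × reg σ I ≡ j × Mixed x j (arr σ POS) (arr σ NEG)

    x+L≤width : ∀ {x} → x ≤ steps L → x + L ≤ width L
    x+L≤width x≤ = ℕ.+-monoˡ-≤ L x≤

    smallL : ∀ {v} → v ≤ L → v < 2 ^ E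
    smallL v≤ = small (ℕ.≤-trans v≤ (L≤steps L))

    extStep-spec : ∀ x o d → Spec extStep (StepInv x o (suc d)) (StepInv x o d) 11
    extStep-spec x o d = Spec-block extStepAtoms proof
      where
      proof : ∀ σ → StepInv x o (suc d) σ →
              AllFit E (toList extStepAtoms) σ × StepInv x o d (⟦ toList extStepAtoms ⟧* σ)
      proof (st s a) (adv@(x+o≡ , (one≡ , _ , _) , _) , inner≡ , (j , j+d≡ , i≡ , mixed)) = allFit , post
        where
        j<L : suc j ≤ L
        j<L = m+1+n≡o⇒m<o j+d≡
        i+1≡ : s I + s ONE ≡ suc j
        i+1≡ = trans (cong₂ _+_ i≡ one≡) (ℕ.+-comm j 1)
        x<steps : suc x ≤ steps L
        x<steps = m+1+n≡o⇒m<o x+o≡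
        cell₀ : Cell x (a POS) (a NEG) (s I)
        cell₀ = subst (Cell x (a POS) (a NEG)) (sym i≡) (proj₂ (mixed j (ℕ.<⇒≤ j<L)) ℕ.≤-refl)
        cell₁ : Cell x (a POS) (a NEG) (s I + s ONE)
        cell₁ = subst (Cell x (a POS) (a NEG)) (sym i+1≡) (proj₂ (mixed (suc j) j<L) (ℕ.n≤1+n j))
        new : Encodes (suc x + L + b) (Δ^ (s I) f x ℤ.+ Δ^ (s I + s ONE) f x)
                      (a POS (s I) + a POS (s I + s ONE)) (a NEG (s I) + a NEG (s I + s ONE))
        new = Encodes-+ cell₀ cell₁
        fitsX : ∀ {v} → v ≤ 2 ^ (x + L + b) → v < 2 ^ E
        fitsX v≤ = fits v≤ (x+L≤width (ℕ.<⇒≤ x<steps))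
        fitsX+1 : ∀ {v} → v ≤ 2 ^ (suc x + L + b) → v < 2 ^ E
        fitsX+1 v≤ = fits v≤ (x+L≤width x<steps)
        sI : s I < 2 ^ E
        sI = smallL (subst (_≤ L) (sym i≡) (ℕ.<⇒≤ j<L))
        sJ : s I + s ONE < 2 ^ E
        sJ = smallL (subst (_≤ L) (sym i+1≡) j<L)
        sONE : s ONE < 2 ^ E
        sONE = smallL (subst (_≤ L) (sym one≡) (ℕ.≤-trans (s≤s z≤n) j<L))
        sINNER : s INNER < 2 ^ E
        sINNER = smallL (subst (_≤ L) (sym inner≡) (m+1+n≡o⇒n<o j+d≡))
        allFit : AllFit E (toList extStepAtoms) (st s a)
        allFit = (sI , sONE) , (sI , fitsX (p≤ cell₀)) , (sJ , fitsX (p≤ cell₁)) ,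
                 (fitsX (p≤ cell₀) , fitsX (p≤ cell₁)) ,
                 (sI , fitsX+1 (p≤ new)) , (sI , fitsX (q≤ cell₀)) , (sJ , fitsX (q≤ cell₁)) ,
                 (fitsX (q≤ cell₀) , fitsX (q≤ cell₁)) , (sI , fitsX+1 (q≤ new)) , (sI , sONE) , (sINNER , sONE) , tt
        post : StepInv x o d (⟦ toList extStepAtoms ⟧* (st s a))
        post = adv , cong₂ _∸_ inner≡ one≡ , suc j , trans (sym (ℕ.+-suc j d)) j+d≡ , i+1≡ ,
               subst₂ (λ u w → Mixed x (suc j) (update (a POS) u (a POS u + a POS w))
                                               (update (a NEG) u (a NEG u + a NEG w)))
                      (sym i≡) (sym i+1≡) (Mixed-step (a POS) (a NEG) x j j<L mixed)

    extLoop-spec : ∀ x o d → Spec (while INNER loop extStep) (StepInv x o d) (StepInv x o 0) (d * (11 + 2) + 1)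
    extLoop-spec x o = Spec-while INNER extStep (StepInv x o) 11 (λ d σ inv → proj₁ (proj₂ inv)) (extStep-spec x o)

    point-start : ∀ x o σ → x + suc o ≡ steps L × Point x (suc o) σ →
                  AllFit E (toList pointStartAtoms) σ × StepInv x o L (⟦ toList pointStartAtoms ⟧* σ)
    point-start x o (st s a) (x+o≡ , frame@(_ , last≡ , _) , outer≡ , x≡ , acc≡ , acc≤ , cells , sums) =
      allFit , (x+o≡ , frame , outer≡ , x≡ , acc′≡ , acc′≤ , sums′) , last≡ , 0 , refl , refl ,
      (λ t t≤L → (λ ()) , (λ _ → cells t t≤L))
      where
      x<steps : suc x ≤ steps L
      x<steps = m+1+n≡o⇒m<o x+o≡
      fitsX : ∀ {v} → v ≤ 2 ^ (x + L + b) → v < 2 ^ E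
      fitsX v≤ = fits v≤ (x+L≤width (ℕ.<⇒≤ x<steps))
      cell₀ : Cell x (a POS) (a NEG) 0
      cell₀ = cells 0 z≤n
      f≡ : a POS 0 ∸ a NEG 0 ≡ chainCount k x
      f≡ = proj₁ (Encodes-+⇒∸ cell₀)
      f≤ : a POS 0 ∸ a NEG 0 ≤ 2 ^ (x + L + b)
      f≤ = proj₂ (Encodes-+⇒∸ cell₀)
      sACC≤ : s ACC ≤ 2 ^ (x + L + b)
      sACC≤ = subst (_≤ 2 ^ (x + L + b)) (sym acc≡) acc≤
      acc′≡ : s ACC + (a POS 0 ∸ a NEG 0) ≡ chainCountBelow k (suc x)
      acc′≡ = trans (cong₂ _+_ acc≡ f≡) (sym (chainCountBelow-suc k x))
      acc′≤ : chainCountBelow k (suc x) ≤ 2 ^ (suc x + L + b)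
      acc′≤ = subst (_≤ 2 ^ (suc x + L + b)) acc′≡ (+-≤2^ (x + L + b) sACC≤ f≤)
      z< : 0 < 2 ^ E
      z< = small z≤n
      allFit : AllFit E (toList pointStartAtoms) (st s a)
      allFit = (small (subst (_≤ steps L) (sym x≡) (ℕ.<⇒≤ x<steps)) , fitsX sACC≤) , z< ,
               (z< , fitsX (p≤ cell₀)) , (z< , fitsX (q≤ cell₀)) , (fitsX (p≤ cell₀) , fitsX (q≤ cell₀)) ,
               (fitsX sACC≤ , fitsX f≤) , z< , (z< , smallL (subst (_≤ L) (sym last≡) ℕ.≤-refl)) , tt
      sums′ : SumsBelow k (width L + b) (suc x) (⟦ toList pointStartAtoms ⟧* (st s a))
      sums′ y y<1+x with toSum (y ≟ s X)
      ... | inj₁ refl = trans (update-same (a SUMS) (s X) (s ACC)) (trans acc≡ (cong (chainCountBelow k) (sym x≡))) ,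
                        subst (_≤ 2 ^ (width L + b)) (sym (update-same (a SUMS) (s X) (s ACC)))
                              (ℕ.≤-trans sACC≤ (ℕ.^-monoʳ-≤ 2 (ℕ.+-monoˡ-≤ b (x+L≤width (ℕ.<⇒≤ x<steps)))))
      ... | inj₂ y≢x rewrite update-other (a SUMS) (s X) (s ACC) y y≢x =
        sums y (<1+n∧≢⇒< y<1+x (λ y≡x → y≢x (trans y≡x (sym x≡))))

    point-end : ∀ x o σ → StepInv x o 0 σ →
                AllFit E (toList pointEndAtoms) σ × ExtInv o (⟦ toList pointEndAtoms ⟧* σ)
    point-end x o (st s a)
              ((x+o≡ , frame@(one≡ , _ , _) , outer≡ , x≡ , acc≡ , acc≤ , sums) , _ , (j , j+0≡ , _ , mixed)) =
      ((small (subst (_≤ steps L) (sym x≡) (ℕ.<⇒≤ x<steps)) , sONE) ,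
       (small (subst (_≤ steps L) (sym outer≡) (m+1+n≡o⇒n<o x+o≡)) , sONE) , tt) ,
      suc x , trans (sym (ℕ.+-suc x o)) x+o≡ ,
      frame , cong₂ _∸_ outer≡ one≡ , trans (cong₂ _+_ x≡ one≡) (ℕ.+-comm x 1) , acc≡ , acc≤ , cells , sums
      where
      x<steps : suc x ≤ steps L
      x<steps = m+1+n≡o⇒m<o x+o≡
      sONE : s ONE < 2 ^ E
      sONE = small (subst (_≤ steps L) (sym one≡) (ℕ.≤-trans (s≤s z≤n) x<steps))
      j≡L : j ≡ L
      j≡L = trans (sym (ℕ.+-identityʳ j)) j+0≡
      cells : Cells (suc x) (st s a)
      cells t t≤L with ℕ.m≤n⇒m<n∨m≡n t≤L
      ... | inj₁ t<L  = proj₁ (mixed t t≤L) (subst (t <_) (sym j≡L) t<L)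
      ... | inj₂ refl = Encodes-mono (ℕ.n≤1+n (x + t + b))
                          (subst (λ v → Encodes (x + t + b) v (a POS t) (a NEG t)) constant
                                 (proj₂ (mixed t t≤L) (ℕ.≤-reflexive j≡L)))
        where
        constant : Δ^ t f x ≡ Δ^ t f (suc x)
        constant = sym (trans (Δ^-suc t f x)
                              (trans (cong (λ z → Δ^ t f x ℤ.+ z) (Δ^-vanishes degree x)) (ℤ.+-identityʳ _)))

    extPoint-spec : ∀ o → Spec extPoint (ExtInv (suc o)) (ExtInv o) (pointBound L)
    extPoint-spec o σ (x , x+o≡ , point) =
      Spec-⨾ (Spec-block pointStartAtoms (point-start x o))
             (Spec-⨾ (extLoop-spec x o L) (Spec-block pointEndAtoms (point-end x o))) σ (x+o≡ , point)

    extension-spec : Spec extension (λ σ → Frame L c σ × Cells 0 σ)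
                                    (λ σ → Frame L c σ × SumsBelow k (width L + b) (steps L) σ) (extensionBound L)
    extension-spec =
      Spec-⨾ (Spec-block extensionStartAtoms start)
             (Spec-weaken (λ _ p → p) finish ℕ.≤-refl
                          (Spec-while OUTER extPoint ExtInv (pointBound L) (λ o σ (_ , _ , _ , outer≡ , _) → outer≡)
                                      extPoint-spec (steps L)))
      where
      start : ∀ σ → Frame L c σ × Cells 0 σ →
              AllFit E (toList extensionStartAtoms) σ × ExtInv (steps L) (⟦ toList extensionStartAtoms ⟧* σ)
      start (st s a) (frame@(one≡ , last≡ , _) , cells) =
        (z< , z< , (sLAST , sLAST) , (small (subst (_≤ steps L) (sym (cong₂ _+_ last≡ last≡)) 2L≤) , sONE) ,
         (small (subst (_≤ steps L) (sym (cong₂ _+_ (cong₂ _+_ last≡ last≡) one≡)) 2L+1≤) , sONE) , tt) ,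
        0 , refl , frame , cong₂ _+_ (cong₂ _+_ (cong₂ _+_ last≡ last≡) one≡) one≡ , refl , refl , z≤n , cells ,
        λ _ ()
        where
        z< : 0 < 2 ^ E
        z< = small z≤n
        sONE : s ONE < 2 ^ E
        sONE = small (subst (_≤ steps L) (sym one≡) (ℕ.m≤n+m 1 (L + L + 1)))
        sLAST : s LAST < 2 ^ E
        sLAST = smallL (subst (_≤ L) (sym last≡) ℕ.≤-refl)
        2L+1≤ : L + L + 1 ≤ steps L
        2L+1≤ = ℕ.m≤m+n (L + L + 1) 1
        2L≤ : L + L ≤ steps L
        2L≤ = ℕ.≤-trans (ℕ.m≤m+n (L + L) 1) 2L+1≤
      finish : ∀ σ → ExtInv 0 σ → Frame L c σ × SumsBelow k (width L + b) (steps L) σ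
      finish σ (x , x+0≡ , frame , _ , _ , _ , _ , _ , sums) =
        frame , subst (λ z → SumsBelow k (width L + b) z σ) (trans (sym (ℕ.+-identityʳ x)) x+0≡) sums

module NextLayerPhase where
  open import Data.List using ([]; _∷_)
  open import Data.List.NonEmpty using (List⁺; _∷_; toList)
  open Machine using (update-same; update-other)
  open WhileLanguage
  open Counting
  open Layout
  open Counters

  nextStepAtoms nextStartAtoms : List⁺ Atom
  nextStepAtoms = I ≔ X + X ∷ I ≔ I + ONE ∷ J ≔ X + ONE ∷ T₁ ≔ SUMS [ I ] ∷ T₂ ≔ SUMS [ J ] ∷
                  T₁ ≔ T₁ ∸ T₂ ∷ POS [ X ]≔ T₁ ∷ NEG [ X ]≔ T₄ ∷ X ≔ X + ONE ∷ OUTER ≔ OUTER ∸ ONE ∷ []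
  nextStartAtoms = X ≔# 0 ∷ T₄ ≔# 0 ∷ OUTER ≔ LAST + ONE ∷ []

  nextStep nextLayer : Cmd
  nextStep  = block nextStepAtoms
  nextLayer = block nextStartAtoms ⨾ while OUTER loop nextStep

  nextBound : ℕ → ℕ
  nextBound L = 3 + (suc L * (10 + 2) + 1)

  module Correctness (E L b c k : ℕ)
    (fits  : ∀ {v} → v ≤ 2 ^ (width L + b) → v < 2 ^ E)
    (small : ∀ {v} → v ≤ steps L → v < 2 ^ E) where
    open HoareLogic E

    NewCells : ℕ → State → Set
    NewCells x σ = ∀ y → y < x →
      arr σ POS y ≡ chainCount (suc k) y × arr σ NEG y ≡ 0 × arr σ POS y ≤ 2 ^ (width L + b)

    Filled : ℕ → ℕ → State → Set
    Filled x o σ = Frame L c σ × reg σ OUTER ≡ o × reg σ X ≡ x × reg σ T₄ ≡ 0 ×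
                   SumsBelow k (width L + b) (steps L) σ × NewCells x σ

    NextInv : ℕ → State → Set
    NextInv o σ = Σ ℕ λ x → x + o ≡ suc L × Filled x o σ

    nextStep-spec : ∀ o → Spec nextStep (NextInv (suc o)) (NextInv o) 10
    nextStep-spec o σ (x , x+o≡ , filled) = Spec-block nextStepAtoms proof σ (x+o≡ , filled)
      where
      proof : ∀ σ → x + suc o ≡ suc L × Filled x (suc o) σ →
              AllFit E (toList nextStepAtoms) σ × NextInv o (⟦ toList nextStepAtoms ⟧* σ)
      proof (st s a) (x+o≡ , frame@(one≡ , _ , _) , outer≡ , x≡ , t₄≡ , sums , cells) = allFit , post
        where
        x≤L : x ≤ L
        x≤L = ℕ.≤-pred (m+1+n≡o⇒m<o x+o≡)
        steps≡ : steps L ≡ suc (suc (L + L))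
        steps≡ = trans (ℕ.+-comm (L + L + 1) 1) (cong suc (ℕ.+-comm (L + L) 1))
        2x+1<steps : suc x + x < steps L
        2x+1<steps = subst (suc (suc x + x) ≤_) (sym steps≡) (s≤s (s≤s (ℕ.+-mono-≤ x≤L x≤L)))
        x+1<steps : suc x < steps L
        x+1<steps = ℕ.≤-<-trans (ℕ.m≤m+n (suc x) x) 2x+1<steps
        i≡ : s X + s X + s ONE ≡ suc x + x
        i≡ = trans (cong₂ _+_ (cong₂ _+_ x≡ x≡) one≡) (ℕ.+-comm (x + x) 1)
        j≡ : s X + s ONE ≡ suc x
        j≡ = trans (cong₂ _+_ x≡ one≡) (ℕ.+-comm x 1)
        sumsI : a SUMS (suc x + x) ≡ chainCountBelow k (suc x + x) × a SUMS (suc x + x) ≤ 2 ^ (width L + b)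
        sumsI = sums (suc x + x) 2x+1<steps
        sumsJ : a SUMS (suc x) ≡ chainCountBelow k (suc x) × a SUMS (suc x) ≤ 2 ^ (width L + b)
        sumsJ = sums (suc x) x+1<steps
        GI≡ : a SUMS (s X + s X + s ONE) ≡ chainCountBelow k (suc x + x)
        GI≡ = trans (cong (a SUMS) i≡) (proj₁ sumsI)
        GJ≡ : a SUMS (s X + s ONE) ≡ chainCountBelow k (suc x)
        GJ≡ = trans (cong (a SUMS) j≡) (proj₁ sumsJ)
        GI≤ : a SUMS (s X + s X + s ONE) ≤ 2 ^ (width L + b)
        GI≤ = subst (_≤ 2 ^ (width L + b)) (cong (a SUMS) (sym i≡)) (proj₂ sumsI)
        GJ≤ : a SUMS (s X + s ONE) ≤ 2 ^ (width L + b)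
        GJ≤ = subst (_≤ 2 ^ (width L + b)) (cong (a SUMS) (sym j≡)) (proj₂ sumsJ)
        new≡ : a SUMS (s X + s X + s ONE) ∸ a SUMS (s X + s ONE) ≡ chainCount (suc k) x
        new≡ = trans (cong₂ _∸_ GI≡ GJ≡) (sym (chainCount-suc-∸ k x))
        new≤ : a SUMS (s X + s X + s ONE) ∸ a SUMS (s X + s ONE) ≤ 2 ^ (width L + b)
        new≤ = ℕ.≤-trans (ℕ.m∸n≤m _ (a SUMS (s X + s ONE))) GI≤
        sX : s X < 2 ^ E
        sX = small (subst (_≤ steps L) (sym x≡) (ℕ.≤-trans (ℕ.n≤1+n x) (ℕ.<⇒≤ x+1<steps)))
        sONE : s ONE < 2 ^ E
        sONE = small (subst (_≤ steps L) (sym one≡) (ℕ.≤-trans (s≤s z≤n) (ℕ.<⇒≤ x+1<steps)))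
        allFit : AllFit E (toList nextStepAtoms) (st s a)
        allFit = (sX , sX) ,
                 (small (subst (_≤ steps L) (sym (cong₂ _+_ x≡ x≡))
                               (ℕ.≤-trans (ℕ.n≤1+n (x + x)) (ℕ.<⇒≤ 2x+1<steps))) ,
                  sONE) ,
                 (sX , sONE) , (small (subst (_≤ steps L) (sym i≡) (ℕ.<⇒≤ 2x+1<steps)) , fits GI≤) ,
                 (small (subst (_≤ steps L) (sym j≡) (ℕ.<⇒≤ x+1<steps)) , fits GJ≤) , (fits GI≤ , fits GJ≤) ,
                 (sX , fits new≤) , (sX , subst (_< 2 ^ E) (sym t₄≡) (small z≤n)) , (sX , sONE) ,
                 (small (subst (_≤ steps L) (sym outer≡) (ℕ.≤-trans (m+1+n≡o⇒n<o x+o≡) (1+L≤steps L))) , sONE) ,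
                 tt
        cells′ : NewCells (suc x) (⟦ toList nextStepAtoms ⟧* (st s a))
        cells′ y y<1+x with toSum (y ≟ s X)
        ... | inj₁ refl = trans (update-same (a POS) (s X) _) (trans new≡ (cong (chainCount (suc k)) (sym x≡))) ,
                          trans (update-same (a NEG) (s X) (s T₄)) t₄≡ ,
                          subst (_≤ 2 ^ (width L + b)) (sym (update-same (a POS) (s X) _)) new≤
        ... | inj₂ y≢x rewrite update-other (a POS) (s X) (a SUMS (s X + s X + s ONE) ∸ a SUMS (s X + s ONE)) y y≢x
                             | update-other (a NEG) (s X) (s T₄) y y≢x =
          cells y (<1+n∧≢⇒< y<1+x (λ y≡x → y≢x (trans y≡x (sym x≡))))
        post : NextInv o (⟦ toList nextStepAtoms ⟧* (st s a))
        post = suc x , trans (sym (ℕ.+-suc x o)) x+o≡ , frame , cong₂ _∸_ outer≡ one≡ , j≡ , t₄≡ , sums , cells′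

    nextLayer-spec : Spec nextLayer (λ σ → Frame L c σ × SumsBelow k (width L + b) (steps L) σ)
                                    (λ σ → Frame L c σ × NewCells (suc L) σ) (nextBound L)
    nextLayer-spec =
      Spec-⨾ (Spec-block nextStartAtoms start)
             (Spec-weaken (λ _ p → p) finish ℕ.≤-refl
                          (Spec-while OUTER nextStep NextInv 10 (λ o σ (_ , _ , _ , outer≡ , _) → outer≡)
                                      nextStep-spec (suc L)))
      where
      start : ∀ σ → Frame L c σ × SumsBelow k (width L + b) (steps L) σ →
              AllFit E (toList nextStartAtoms) σ × NextInv (suc L) (⟦ toList nextStartAtoms ⟧* σ)
      start (st s a) (frame@(one≡ , last≡ , _) , sums) =
        (small z≤n , small z≤n ,
         (small (subst (_≤ steps L) (sym last≡) (L≤steps L)) ,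
          small (subst (_≤ steps L) (sym one≡) (ℕ.m≤n+m 1 (L + L + 1)))) , tt) ,
        0 , refl , frame , trans (cong₂ _+_ last≡ one≡) (ℕ.+-comm L 1) , refl , refl , sums , λ _ ()
      finish : ∀ σ → NextInv 0 σ → Frame L c σ × NewCells (suc L) σ
      finish σ (x , x+0≡ , frame , _ , _ , _ , _ , cells) =
        frame , subst (λ z → NewCells z σ) (trans (sym (ℕ.+-identityʳ x)) x+0≡) cells

module MainProgram where
  open import Data.List using ([]; _∷_)
  open import Data.List.NonEmpty using (List⁺; _∷_; toList)
  open Machine using (update-same; update-other)
  open WhileLanguage
  open Counting
  open FiniteDifferences
  open SignedPairs
  open Layout
  open Counters
  open DifferencePhase using (differences; differencesBound; diffTable-zero; diffTable-≤)
  open ExtensionPhase using (extension; extensionBound)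
  open NextLayerPhase using (nextLayer; nextBound)

  setupAtoms initStepAtoms finishAtoms : List⁺ Atom
  setupAtoms    = ONE ≔# 1 ∷ LAST ≔ IO + ONE ∷ I ≔# 0 ∷ INNER ≔ LAST + ONE ∷ []
  initStepAtoms = POS [ I ]≔ ONE ∷ I ≔ I + ONE ∷ INNER ≔ INNER ∸ ONE ∷ []
  finishAtoms   = I ≔# 1 ∷ IO ≔ POS [ I ] ∷ []

  layer program : Cmd
  layer   = differences ⨾ extension ⨾ nextLayer ⨾ atom (LAYER ≔ LAYER ∸ ONE)
  program = block setupAtoms ⨾ while INNER loop block initStepAtoms ⨾ atom (LAYER ≔ IO ∸ ONE) ⨾
            while LAYER loop layer ⨾ block finishAtoms

  layerBound : ℕ → ℕ
  layerBound L = differencesBound L + (extensionBound L + (nextBound L + 1))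

  programBound : ℕ → ℕ
  programBound n = 4 + ((suc (suc n) * (3 + 2) + 1) + (1 + (((n ∸ 1) * (layerBound (suc n) + 2) + 1) + 2)))

  -- Every number the program handles on input n is below 2 ^ bits n.
  bits : ℕ → ℕ
  bits n = suc (width (suc n) * suc n)

  n<2^n : ∀ n → n < 2 ^ n
  n<2^n zero    = s≤s z≤n
  n<2^n (suc n) = ℕ.≤-trans (ℕ.+-mono-≤ (ℕ.^-monoʳ-≤ 2 {0} {n} z≤n) (n<2^n n))
                            (ℕ.≤-reflexive (cong (2 ^ n +_) (sym (ℕ.+-identityʳ (2 ^ n)))))

  module Correctness (n : ℕ) where
    L : ℕ
    L = suc n
    E : ℕ
    E = bits n
    open HoareLogic E

    below2^E : ∀ {v e} → v ≤ 2 ^ e → e ≤ width L * L → v < 2 ^ E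
    below2^E v≤ e≤ =
      ℕ.≤-<-trans (ℕ.≤-trans v≤ (ℕ.^-monoʳ-≤ 2 e≤))
                  (ℕ.^-monoʳ-< 2 (s≤s (s≤s z≤n)) (ℕ.n<1+n (width L * L)))

    fitsLayer : ∀ k → suc k ≤ L → ∀ {v e} → v ≤ 2 ^ (e + width L * k) → e ≤ width L → v < 2 ^ E
    fitsLayer k k<L v≤ e≤ = below2^E v≤
      (ℕ.≤-trans (ℕ.+-monoˡ-≤ (width L * k) e≤)
                 (subst (_≤ width L * L) (ℕ.*-suc (width L) k) (ℕ.*-monoʳ-≤ (width L) k<L)))

    small : ∀ {v} → v ≤ steps L → v < 2 ^ E
    small v≤ = below2^E (ℕ.<⇒≤ (ℕ.≤-<-trans v≤ (n<2^n (steps L))))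
                        (ℕ.≤-trans (ℕ.m≤m+n (steps L) L) (ℕ.m≤m*n (width L) L))

    LayerState : ℕ → ℕ → State → Set
    LayerState k o σ = Frame L o σ ×
      (∀ x → x ≤ L → arr σ POS x ≡ chainCount k x × arr σ NEG x ≡ 0 × arr σ POS x ≤ 2 ^ (width L * k))

    LayersInv : ℕ → State → Set
    LayersInv o σ = Σ ℕ λ k → k + o ≡ n ∸ 1 × LayerState k o σ

    module Layer (k o : ℕ) (k+o≡ : k + suc o ≡ n ∸ 1) where
      b : ℕ
      b = width L * k

      k+o≤n : k + suc o ≤ n
      k+o≤n = subst (_≤ n) (sym k+o≡) (ℕ.m∸n≤m n 1)

      k<L : suc k ≤ L
      k<L = s≤s (ℕ.≤-trans (ℕ.m≤m+n k (suc o)) k+o≤n)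

      fits : ∀ {v e} → v ≤ 2 ^ (e + b) → e ≤ width L → v < 2 ^ E
      fits = fitsLayer k k<L

      module D = DifferencePhase.Correctness E L b (suc o) (chainCountℤ k)
                   (λ v≤ e≤ → fits v≤ (ℕ.≤-trans e≤ (L≤width L)))
                   (λ v≤ → small (ℕ.≤-trans v≤ (L≤steps L)))
      module X = ExtensionPhase.Correctness E L b (suc o) k
                   (Degree<-mono (s≤s (ℕ.<⇒≤ k<L)) (chainCount-Degree< k)) fits small
      module N = NextLayerPhase.Correctness E L b (suc o) k (λ v≤ → fits v≤ ℕ.≤-refl) small

      toDifferences : ∀ σ → LayerState k (suc o) σ → Frame L (suc o) σ × D.Table 0 σ
      toDifferences σ (frame , cells) = frame , λ t t≤L → cell t (cells t t≤L)
        where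
        cell : ∀ t → arr σ POS t ≡ chainCount k t × arr σ NEG t ≡ 0 × arr σ POS t ≤ 2 ^ b →
               D.Cell 0 (arr σ POS) (arr σ NEG) t
        cell t (pos≡ , neg≡ , pos≤) =
          encodes (trans (cong₂ _⊖_ pos≡ neg≡) (sym (diffTable-zero (chainCountℤ k) t)))
                  pos≤ (subst (_≤ 2 ^ b) (sym neg≡) z≤n)

      toExtension : ∀ σ → Frame L (suc o) σ × D.Table L σ → Frame L (suc o) σ × X.Cells 0 σ
      toExtension σ (frame , table) = frame , λ t t≤L → cell t t≤L (table t t≤L)
        where
        cell : ∀ t → t ≤ L → D.Cell L (arr σ POS) (arr σ NEG) t → X.Cell 0 (arr σ POS) (arr σ NEG) t
        cell t t≤L (encodes ≡v p≤ q≤) = encodes (trans ≡v (diffTable-≤ (chainCountℤ k) t≤L)) p≤ q≤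

      finish : ∀ σ → Frame L (suc o) σ × N.NewCells (suc L) σ →
               Fits E (LAYER ≔ LAYER ∸ ONE) σ × LayersInv o (⟦ LAYER ≔ LAYER ∸ ONE ⟧ σ)
      finish (st s a) ((one≡ , last≡ , layer≡) , cells) =
        (small (subst (_≤ steps L) (sym layer≡)
                      (ℕ.≤-trans (ℕ.m≤n+m (suc o) k) (ℕ.≤-trans k+o≤n (ℕ.≤-trans (ℕ.n≤1+n n) (L≤steps L))))) ,
         small (subst (_≤ steps L) (sym one≡) (ℕ.≤-trans (s≤s z≤n) (L≤steps L)))) ,
        suc k , trans (sym (ℕ.+-suc k o)) k+o≡ , (one≡ , last≡ , cong₂ _∸_ layer≡ one≡) , cells′
        where
        cells′ : ∀ x → x ≤ L → a POS x ≡ chainCount (suc k) x × a NEG x ≡ 0 × a POS x ≤ 2 ^ (width L * suc k)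
        cells′ x x≤L with cells x (s≤s x≤L)
        ... | pos≡ , neg≡ , pos≤ = pos≡ , neg≡ , subst (λ e → a POS x ≤ 2 ^ e) (sym (ℕ.*-suc (width L) k)) pos≤

      layer-spec : Spec layer (LayerState k (suc o)) (LayersInv o) (layerBound L)
      layer-spec = Spec-⨾ (Spec-weaken toDifferences (λ _ q → q) ℕ.≤-refl D.differences-spec)
                     (Spec-⨾ (Spec-weaken toExtension (λ _ q → q) ℕ.≤-refl X.extension-spec)
                       (Spec-⨾ N.nextLayer-spec (Spec-atom (LAYER ≔ LAYER ∸ ONE) finish)))

    layers-spec : ∀ o → Spec (while LAYER loop layer) (LayersInv o) (LayersInv 0) (o * (layerBound L + 2) + 1)
    layers-spec = Spec-while LAYER layer LayersInv (layerBound L) (λ o σ (_ , _ , (_ , _ , layer≡) , _) → layer≡)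
                             (λ o σ (k , k+o≡ , state) → Layer.layer-spec k o k+o≡ σ state)

    Initialised : ℕ → ℕ → State → Set
    Initialised i o σ = reg σ ONE ≡ 1 × reg σ LAST ≡ L × reg σ IO ≡ n × reg σ INNER ≡ o ×
                        reg σ I ≡ i × (∀ y → y < i → arr σ POS y ≡ 1) × (∀ y → arr σ NEG y ≡ 0)

    InitInv : ℕ → State → Set
    InitInv o σ = Σ ℕ λ i → i + o ≡ suc L × Initialised i o σ

    initStep-spec : ∀ o → Spec (block initStepAtoms) (InitInv (suc o)) (InitInv o) 3
    initStep-spec o σ (i , i+o≡ , inv) = Spec-block initStepAtoms proof σ (i+o≡ , inv)
      where
      proof : ∀ σ → i + suc o ≡ suc L × Initialised i (suc o) σ →
              AllFit E (toList initStepAtoms) σ × InitInv o (⟦ toList initStepAtoms ⟧* σ)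
      proof (st s a) (i+o≡ , one≡ , last≡ , io≡ , inner≡ , i≡ , ones , zeros) =
        ((sI , sONE) , (sI , sONE) , (sINNER , sONE) , tt) ,
        suc i , trans (sym (ℕ.+-suc i o)) i+o≡ , one≡ , last≡ , io≡ , cong₂ _∸_ inner≡ one≡ ,
        trans (cong₂ _+_ i≡ one≡) (ℕ.+-comm i 1) , ones′ , zeros
        where
        i≤L : i ≤ L
        i≤L = ℕ.≤-pred (m+1+n≡o⇒m<o i+o≡)
        sI : s I < 2 ^ E
        sI = small (subst (_≤ steps L) (sym i≡) (ℕ.≤-trans i≤L (L≤steps L)))
        sONE : s ONE < 2 ^ E
        sONE = small (subst (_≤ steps L) (sym one≡) (ℕ.≤-trans (s≤s z≤n) (L≤steps L)))
        sINNER : s INNER < 2 ^ E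
        sINNER = small (subst (_≤ steps L) (sym inner≡)
                              (ℕ.≤-trans (m+1+n≡o⇒n<o i+o≡) (1+L≤steps L)))
        ones′ : ∀ y → y < suc i → update (a POS) (s I) (s ONE) y ≡ 1
        ones′ y y<1+i with toSum (y ≟ s I)
        ... | inj₁ refl = trans (update-same (a POS) (s I) (s ONE)) one≡
        ... | inj₂ y≢i = trans (update-other (a POS) (s I) (s ONE) y y≢i)
                               (ones y (<1+n∧≢⇒< y<1+i (λ y≡i → y≢i (trans y≡i (sym i≡)))))

    Input : State → Set
    Input σ = reg σ IO ≡ n × (∀ y → arr σ NEG y ≡ 0)

    program-spec : Spec program Input (λ σ → reg σ IO ≡ tournamentCount n) (programBound n)
    program-spec =
      Spec-⨾ (Spec-block setupAtoms setup)
        (Spec-⨾ (Spec-while INNER (block initStepAtoms) InitInv 3 (λ o σ (_ , _ , _ , _ , _ , inner≡ , _) → inner≡)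
                            initStep-spec (suc L))
          (Spec-⨾ (Spec-atom (LAYER ≔ IO ∸ ONE) startLayers)
            (Spec-⨾ (layers-spec (n ∸ 1)) (Spec-block finishAtoms finish))))
      where
      1<2^E : 1 < 2 ^ E
      1<2^E = small (ℕ.≤-trans (s≤s z≤n) (L≤steps L))

      n<2^E : n < 2 ^ E
      n<2^E = small (ℕ.≤-trans (ℕ.n≤1+n n) (L≤steps L))

      setup : ∀ σ → Input σ → AllFit E (toList setupAtoms) σ × InitInv (suc L) (⟦ toList setupAtoms ⟧* σ)
      setup (st s a) (io≡ , zeros) =
        (1<2^E , (subst (_< 2 ^ E) (sym io≡) n<2^E , 1<2^E) , small z≤n ,
         (small (subst (_≤ steps L) (sym last≡) (L≤steps L)) , 1<2^E) , tt) ,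
        0 , refl , refl , last≡ , io≡ , trans (cong (_+ 1) last≡) (ℕ.+-comm L 1) , refl , (λ _ ()) , zeros
        where
        last≡ : s IO + 1 ≡ L
        last≡ = trans (cong (_+ 1) io≡) (ℕ.+-comm n 1)

      startLayers : ∀ σ → InitInv 0 σ →
                    Fits E (LAYER ≔ IO ∸ ONE) σ × LayersInv (n ∸ 1) (⟦ LAYER ≔ IO ∸ ONE ⟧ σ)
      startLayers (st s a) (i , i+0≡ , one≡ , last≡ , io≡ , _ , _ , ones , zeros) =
        (subst (_< 2 ^ E) (sym io≡) n<2^E , subst (_< 2 ^ E) (sym one≡) 1<2^E) ,
        0 , refl , (one≡ , last≡ , cong₂ _∸_ io≡ one≡) , λ x x≤L →
          ones x (subst (x <_) (sym i≡) (s≤s x≤L)) , zeros x ,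
          subst (λ e → a POS x ≤ 2 ^ e) (sym (ℕ.*-zeroʳ (width L)))
                (ℕ.≤-reflexive (ones x (subst (x <_) (sym i≡) (s≤s x≤L))))
        where
        i≡ : i ≡ suc L
        i≡ = trans (sym (ℕ.+-identityʳ i)) i+0≡

      finish : ∀ σ → LayersInv 0 σ →
               AllFit E (toList finishAtoms) σ × reg (⟦ toList finishAtoms ⟧* σ) IO ≡ tournamentCount n
      finish (st s a) (k , k+0≡ , _ , cells) =
        (1<2^E , (1<2^E , below2^E pos≤ (ℕ.*-monoʳ-≤ (width L) k≤L)) , tt) ,
        trans pos≡ (cong (λ j → chainCount j 1) k≡)
        where
        k≡ : k ≡ n ∸ 1
        k≡ = trans (sym (ℕ.+-identityʳ k)) k+0≡
        k≤L : k ≤ L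
        k≤L = ℕ.≤-trans (subst (_≤ n) (sym k≡) (ℕ.m∸n≤m n 1)) (ℕ.n≤1+n n)
        pos≡ : a POS 1 ≡ chainCount k 1
        pos≡ = proj₁ (cells 1 (s≤s z≤n))
        pos≤ : a POS 1 ≤ 2 ^ (width L * k)
        pos≤ = proj₂ (proj₂ (cells 1 (s≤s z≤n)))

module PolynomialBounds (N : ℕ) .{{_ : NonZero N}} where
  open import Data.Nat.Tactic.RingSolver using (solve-∀)

  -- A record rather than a ≤ c * N ^ k, so that a, c and k can be inferred.
  infix 4 _≲_·N^_
  record _≲_·N^_ (a c k : ℕ) : Set where
    constructor ≲⟨_⟩
    field bound : a ≤ c * N ^ k
  open _≲_·N^_ public

  ≲-N : N ≲ 1 ·N^ 1
  ≲-N = ≲⟨ ℕ.≤-reflexive (sym (trans (ℕ.+-identityʳ (N * 1)) (ℕ.*-identityʳ N))) ⟩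

  ≲-const : ∀ c {k} → c ≲ c ·N^ k
  ≲-const c {k} = ≲⟨ subst (_≤ c * N ^ k) (ℕ.*-identityʳ c) (ℕ.*-monoʳ-≤ c (ℕ.m^n>0 N k)) ⟩

  ≲-+ : ∀ {k c d a b} → a ≲ c ·N^ k → b ≲ d ·N^ k → a + b ≲ (c + d) ·N^ k
  ≲-+ {k} {c} {d} {a} {b} ≲⟨ a≤ ⟩ ≲⟨ b≤ ⟩ =
    ≲⟨ subst (a + b ≤_) (sym (ℕ.*-distribʳ-+ (N ^ k) c d)) (ℕ.+-mono-≤ a≤ b≤) ⟩

  ≲-* : ∀ {i j c d a b} → a ≲ c ·N^ i → b ≲ d ·N^ j → a * b ≲ (c * d) ·N^ (i + j)
  ≲-* {i} {j} {c} {d} {a} {b} ≲⟨ a≤ ⟩ ≲⟨ b≤ ⟩ =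
    ≲⟨ subst (a * b ≤_) (trans (interchange c (N ^ i) d (N ^ j)) (cong ((c * d) *_) (sym (ℕ.^-distribˡ-+-* N i j))))
             (ℕ.*-mono-≤ a≤ b≤) ⟩
    where
    interchange : ∀ c x d y → (c * x) * (d * y) ≡ (c * d) * (x * y)
    interchange = solve-∀

  ≲-raise : ∀ {i j c a} → i ≤ j → a ≲ c ·N^ i → a ≲ c ·N^ j
  ≲-raise {c = c} i≤j ≲⟨ a≤ ⟩ = ≲⟨ ℕ.≤-trans a≤ (ℕ.*-monoʳ-≤ c (ℕ.^-monoʳ-≤ N i≤j)) ⟩

  ≲-≤ : ∀ {k c a b} → a ≤ b → b ≲ c ·N^ k → a ≲ c ·N^ k
  ≲-≤ a≤b ≲⟨ b≤ ⟩ = ≲⟨ ℕ.≤-trans a≤b b≤ ⟩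

module Complexity where
  open import Data.List using (length)
  open import Data.Maybe using (just)
  open Machine
  open WhileLanguage
  open Compilation
  open Counting
  open Layout
  open DifferencePhase using (levelBound; differencesBound)
  open ExtensionPhase using (pointBound; extensionBound)
  open NextLayerPhase using (nextBound)
  open MainProgram

  module _ (n : ℕ) where
    open PolynomialBounds (suc n)

    steps≲ : steps (suc n) ≲ 4 ·N^ 1
    steps≲ = ≲-+ (≲-+ (≲-+ ≲-N ≲-N) (≲-const 1)) (≲-const 1)

    width≲ : width (suc n) ≲ 5 ·N^ 1
    width≲ = ≲-+ steps≲ ≲-N

    bits≲ : bits n ≲ 6 ·N^ 2
    bits≲ = ≲-+ (≲-const 1) (≲-* width≲ ≲-N)

    atomCost≲ : atomCost (bits n) ≲ 140 ·N^ 2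
    atomCost≲ = ≲-* (≲-const 7 {0}) (≲-* (≲-const 2 {0}) (≲-+ (≲-const 1) (≲-+ bits≲ (≲-const 3))))

    levelBound≲ : levelBound (suc n) ≲ 19 ·N^ 1
    levelBound≲ = ≲-+ (≲-const 4) (≲-+ (≲-+ (≲-* ≲-N (≲-const 13 {0})) (≲-const 1)) (≲-const 1))

    differencesBound≲ : differencesBound (suc n) ≲ 24 ·N^ 2
    differencesBound≲ = ≲-+ (≲-const 2) (≲-+ (≲-* ≲-N (≲-+ levelBound≲ (≲-const 2))) (≲-const 1))

    pointBound≲ : pointBound (suc n) ≲ 24 ·N^ 1
    pointBound≲ = ≲-+ (≲-const 8) (≲-+ (≲-+ (≲-* ≲-N (≲-const 13 {0})) (≲-const 1)) (≲-const 2))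

    extensionBound≲ : extensionBound (suc n) ≲ 110 ·N^ 2
    extensionBound≲ = ≲-+ (≲-const 5) (≲-+ (≲-* steps≲ (≲-+ pointBound≲ (≲-const 2))) (≲-const 1))

    nextBound≲ : nextBound (suc n) ≲ 28 ·N^ 2
    nextBound≲ =
      ≲-raise (s≤s z≤n) (≲-+ (≲-const 3) (≲-+ (≲-* (≲-+ (≲-const 1) ≲-N) (≲-const 12 {0})) (≲-const 1)))

    layerBound≲ : layerBound (suc n) ≲ 163 ·N^ 2
    layerBound≲ = ≲-+ differencesBound≲ (≲-+ extensionBound≲ (≲-+ nextBound≲ (≲-const 1)))

    programBound≲ : programBound n ≲ 184 ·N^ 3
    programBound≲ =
      ≲-+ (≲-const 4)
          (≲-+ (≲-raise (s≤s z≤n) (≲-+ (≲-* (≲-+ (≲-const 1) ≲-N) (≲-const 5 {0})) (≲-const 1)))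
               (≲-+ (≲-const 1)
                    (≲-+ (≲-+ (≲-* (≲-≤ (ℕ.≤-trans (ℕ.m∸n≤m n 1) (ℕ.n≤1+n n)) ≲-N)
                                   (≲-+ layerBound≲ (≲-const 2)))
                              (≲-const 1))
                         (≲-const 2))))

    cost≲ : programBound n * atomCost (bits n) ≲ 25760 ·N^ 6
    cost≲ = ≲-raise (ℕ.n≤1+n 5) (≲-* programBound≲ atomCost≲)

    open Correctness n
    open HoareLogic (bits n) using (Terminates)
    open Terminates
    open Simulated

    initialMemory : Memory
    initialMemory = update (λ _ → 0) 0 n

    initialState : State
    initialState = st initialMemory (λ _ _ → 0)

    run-program : Terminates program initialState (λ σ → reg σ IO ≡ tournamentCount n) (programBound n)
    run-program = program-spec initialState (refl , λ _ → refl)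

    simulation : Simulated (compile 0 program) 0 program initialMemory (final run-program)
                           (count run-program * atomCost (bits n))
    simulation = compile-correct (s≤s (s≤s z≤n)) (execution run-program) tt (λ a → a)
                                 ((λ _ _ → refl) , (λ _ _ _ → refl))

    program-computes : Computes (compile 0 program) n (tournamentCount n) (25760 * suc n ^ 6)
    program-computes =
      Reach⇒Computes (subst (λ p → Reach (compile 0 program) (initial n) (cfg p (memory simulation) (spent simulation)))
                            (sym (length-compile 0 program)) (reach simulation))
                     (trans (proj₁ (represents simulation) 0 (s≤s z≤n)) (post run-program))
                     (ℕ.≤-trans (spent≤ simulation)
                                (ℕ.≤-trans (ℕ.*-monoˡ-≤ (atomCost (bits n)) (count≤ run-program)) (bound cost≲)))

theorem1 : Σ Program λ P → Σ ℕ λ C → (n : ℕ) →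
    Σ ℕ λ s → (Fin s ↔ TournamentSeq n) × Computes P n s (C * (suc n ^ 6))
theorem1 = compile 0 program , 25760 , λ n → tournamentCount n , Fin-tournamentCount↔ n , program-computes n
  where
  open Counting
  open Compilation
  open MainProgram
  open Complexity
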